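{- Let $\Sigma=(\Gamma,\sigma)$ be a signed graph with underlying graph $\Gamma=(V,E)$, let $S$ be a finite set and $\iota:S\to S$ an involution, and let $t=|\{s\in S:\iota(s)=s\}|$. Then the number of proper $(S,\iota)$-colorings of $\Sigma$ is $$P_\Sigma(S,\iota)=(-1)^{|V|-k(\Sigma)}|S|^{k(\Sigma)}T_\Sigma\Big(1-|S|,0,1-\frac{t}{|S|}\Big).$$
   Context: A signed graph $\Sigma=(\Gamma,\sigma)$: finite graph $\Gamma=(V,E)$ (loops, multiple edges allowed), $\sigma:E\to\{ -1,1\}$. A cycle (loops included) is balanced if the product of its edge signs is $1$, unbalanced otherwise. For $A\subseteq E$, $\Sigma\backslash A^c$ is the spanning signed subgraph $(V,A)$. $k,k_b,k_u$: numbers of connected components, balanced components, unbalanced components. Signed Tutte polynomial: $$T_\Sigma(X,Y,Z)=\sum_{A\subseteq E}(X-1)^{k(\Sigma\backslash A^c)-k(\Sigma)}(Y-1)^{|A|-|V|+k_b(\Sigma\backslash A^c)}(Z-1)^{k_u(\Sigma\backslash A^c)}.$$ A proper $(S,\iota)$-coloring of $\Sigma$ is a map $f:V\to S$ such that for every edge $e$ with endpoints $u,v$: $f(u)\ne f(v)$ if $e$ is positive, and $\iota(f(u))\ne f(v)$ if $e$ is negative. -}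

module Defs where

open import Data.Bool using (Bool; true; false; _∧_; _∨_; not; if_then_else_)
open import Data.Nat as ℕ using (ℕ; zero; suc; _∸_)
open import Data.Fin using (Fin; zero; suc; toℕ; _<_)
open import Data.Fin.Properties using (_≟_)
open import Data.Bool.ListAction using (any; all)
open import Data.List using (List; []; _∷_; length; map; filter; concatMap; foldr; lookup; allFin; upTo; _++_; sum)
open import Data.Product using (_×_; _,_; proj₁; proj₂)
open import Data.Integer as ℤ using (ℤ; +_)
open import Data.Rational using (ℚ; 1ℚ; _*_; _+_)
open import Relation.Nullary.Decidable using (⌊_⌋)
open import Relation.Binary.PropositionalEquality using (_≡_)

-- An edge is a pair of endpoints together with a sign
-- (true = positive, false = negative).  Loops (u = v) and multiple
-- edges (repeated entries) are allowed.

Sign : Set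
Sign = Bool

record SignedGraph (n : ℕ) : Set where
  field
    edges : List (Fin n × Fin n × Sign)

  nE : ℕ
  nE = length edges

  Edge : Set
  Edge = Fin nE

  ends₁ : Edge → Fin n
  ends₁ e = proj₁ (lookup edges e)

  ends₂ : Edge → Fin n
  ends₂ e = proj₁ (proj₂ (lookup edges e))

  sign : Edge → Sign
  sign e = proj₂ (proj₂ (lookup edges e))

open SignedGraph public

_==_ : ∀ {n} → Fin n → Fin n → Bool
a == b = ⌊ a ≟ b ⌋

count : ∀ {A : Set} → (A → Bool) → List A → ℕ
count p xs = length (filter (λ x → Relation.Nullary.Decidable.Core.T? (p x)) xs)
  where import Relation.Nullary.Decidable.Core

seqs : ∀ {A : Set} → List A → ℕ → List (List A)
seqs xs zero    = [] ∷ []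
seqs xs (suc ℓ) = concatMap (λ x → map (x ∷_) (seqs xs ℓ)) xs

allFuns : ∀ {B : Set} (n : ℕ) → List B → List (Fin n → B)
allFuns zero    bs = (λ ()) ∷ []
allFuns (suc n) bs =
  concatMap (λ b → map (λ f → λ { zero → b ; (suc i) → f i }) (allFuns n bs)) bs

distinct : ∀ {k} → List (Fin k) → Bool
distinct []       = true
distinct (x ∷ xs) = not (any (x ==_) xs) ∧ distinct xs

EdgeSet : ∀ {n} → SignedGraph n → Set
EdgeSet Σ = Edge Σ → Bool

allEdgeSets : ∀ {n} (Σ : SignedGraph n) → List (EdgeSet Σ)
allEdgeSets Σ = allFuns (nE Σ) (true ∷ false ∷ [])

fullSet : ∀ {n} (Σ : SignedGraph n) → EdgeSet Σ
fullSet Σ _ = true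

card : ∀ {n} (Σ : SignedGraph n) → EdgeSet Σ → ℕ
card Σ A = count A (allFin (nE Σ))

joins : ∀ {n} (Σ : SignedGraph n) → Edge Σ → Fin n → Fin n → Bool
joins Σ e u w = (ends₁ Σ e == u ∧ ends₂ Σ e == w) ∨ (ends₁ Σ e == w ∧ ends₂ Σ e == u)

adj : ∀ {n} (Σ : SignedGraph n) → EdgeSet Σ → Fin n → Fin n → Bool
adj Σ A u w = any (λ e → A e ∧ joins Σ e u w) (allFin (nE Σ))

reachWithin : ∀ {n} (Σ : SignedGraph n) → EdgeSet Σ → ℕ → Fin n → Fin n → Bool
reachWithin Σ A zero    v w = v == w
reachWithin Σ A (suc i) v w =
  reachWithin Σ A i v w ∨ any (λ u → reachWithin Σ A i v u ∧ adj Σ A u w) (allFin _)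

-- same connected component of (V, A)  (walks of length ≤ n suffice)
sameComp : ∀ {n} (Σ : SignedGraph n) → EdgeSet Σ → Fin n → Fin n → Bool
sameComp {n} Σ A v w = reachWithin Σ A n v w

-- v is the least vertex of its component: one representative per component
isRep : ∀ {n} (Σ : SignedGraph n) → EdgeSet Σ → Fin n → Bool
isRep Σ A v = all (λ u → not (⌊ toℕ u ℕ.<? toℕ v ⌋ ∧ sameComp Σ A u v)) (allFin _)

-- A cycle of length ℓ ≥ 1 in (V, A) is a list
-- (v₀,e₁),(v₁,e₂),…,(v_{ℓ-1},e_ℓ) with the vᵢ pairwise distinct, the
-- eᵢ pairwise distinct edges of A, eᵢ joining v_{i-1} and vᵢ and e_ℓ
-- joining v_{ℓ-1} and v₀ (ℓ = 1: a loop; ℓ = 2: two parallel edges).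

linked : ∀ {n} (Σ : SignedGraph n) → Fin n → List (Fin n × Edge Σ) → Bool
linked Σ v₀ []                       = true
linked Σ v₀ ((v , e) ∷ [])           = joins Σ e v v₀
linked Σ v₀ ((v , e) ∷ (w , f) ∷ xs) = joins Σ e v w ∧ linked Σ v₀ ((w , f) ∷ xs)

isCycle : ∀ {n} (Σ : SignedGraph n) → EdgeSet Σ → List (Fin n × Edge Σ) → Bool
isCycle Σ A []              = false
isCycle Σ A c@((v₀ , _) ∷ _) =
  all (λ p → A (proj₂ p)) c ∧ distinct (map proj₁ c) ∧ distinct (map proj₂ c)
  ∧ linked Σ v₀ c

signProduct : ∀ {n} (Σ : SignedGraph n) → List (Fin n × Edge Σ) → Sign
signProduct Σ []             = true
signProduct Σ ((_ , e) ∷ xs) = if sign Σ e then signProduct Σ xs else not (signProduct Σ xs)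

-- all candidate cycles (a cycle has at most n distinct vertices)
candidates : ∀ {n} (Σ : SignedGraph n) → List (List (Fin n × Edge Σ))
candidates {n} Σ =
  concatMap (λ ℓ → seqs (concatMap (λ v → map (v ,_) (allFin (nE Σ))) (allFin n)) ℓ)
            (Data.List.map suc (upTo n))

compUnbalanced : ∀ {n} (Σ : SignedGraph n) → EdgeSet Σ → Fin n → Bool
compUnbalanced Σ A v = any ok (candidates Σ)
  where
  ok : _ → Bool
  ok []            = false
  ok c@((w , _) ∷ _) = isCycle Σ A c ∧ not (signProduct Σ c) ∧ sameComp Σ A v w

-- k, k_b, k_u of the spanning subgraph Σ \ A^c = (V, A)

kc : ∀ {n} (Σ : SignedGraph n) → EdgeSet Σ → ℕ
kc Σ A = count (isRep Σ A) (allFin _)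

ku : ∀ {n} (Σ : SignedGraph n) → EdgeSet Σ → ℕ
ku Σ A = count (λ v → isRep Σ A v ∧ compUnbalanced Σ A v) (allFin _)

kb : ∀ {n} (Σ : SignedGraph n) → EdgeSet Σ → ℕ
kb Σ A = count (λ v → isRep Σ A v ∧ not (compUnbalanced Σ A v)) (allFin _)

-- Signed Tutte polynomial evaluated at rationals X, Y, Z.
-- The exponents k(Σ\A^c) - k(Σ) and |A| - |V| + k_b(Σ\A^c) are always
-- ≥ 0, so truncated subtraction ∸ computes them exactly.

_^_ : ℚ → ℕ → ℚ
x ^ zero  = 1ℚ
x ^ suc k = x * (x ^ k)

sumℚ : List ℚ → ℚ
sumℚ = foldr _+_ (Data.Rational.0ℚ)

tutte : ∀ {n} (Σ : SignedGraph n) → ℚ → ℚ → ℚ → ℚ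
tutte {n} Σ X Y Z = sumℚ (map term (allEdgeSets Σ))
  where
  open Data.Rational using (_-_)
  term : EdgeSet Σ → ℚ
  term A = ((X - 1ℚ) ^ (kc Σ A ∸ kc Σ (fullSet Σ)))
         * (((Y - 1ℚ) ^ ((card Σ A ℕ.+ kb Σ A) ∸ n))
         * ((Z - 1ℚ) ^ ku Σ A))

proper : ∀ {n m} (Σ : SignedGraph n) (ι : Fin m → Fin m) → (Fin n → Fin m) → Bool
proper Σ ι f = all ok (allFin (nE Σ))
  where
  ok : Edge Σ → Bool
  ok e = if sign Σ e
         then not (f (ends₁ Σ e) == f (ends₂ Σ e))
         else not (ι (f (ends₁ Σ e)) == f (ends₂ Σ e))

chromatic : ∀ {n m} (Σ : SignedGraph n) (ι : Fin m → Fin m) → ℕ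
chromatic {n} {m} Σ ι = count (proper Σ ι) (allFuns n (allFin m))

fixedPoints : ∀ {m} → (Fin m → Fin m) → ℕ
fixedPoints {m} ι = count (λ s → ι s == s) (allFin m)

-- Expanding the indicator of properness ∏ₑ (1 − [f is improper on e]) over edge subsets gives
-- P = ∑_A (−1)^|A| N(A), where N(A) counts the colourings improper on every edge of A. Such a
-- colouring is transported along walks of (V, A), twisted by ι at negative edges, so it is
-- determined by its values at one vertex per component: any of the |S| colours on a balanced
-- component, and one of the t fixed points of ι on an unbalanced one, where a negative cycle
-- forces f v = ι (f v). Hence N(A) = |S|^k_b(A) t^k_u(A), and the identity holds term by term.
-- The truncated subtractions in the exponents are exact because k(Σ) ≤ k(A) ≤ |V| and
-- |V| ≤ |A| + k_b(A). The last inequality comes from the same count with S = ℤ₃ and ι = −: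
-- then N(A) = 3^k_b(A) and N(∅) = 3^|V|, and deleting an edge at most triples N, since the
-- colourings improper on A ∖ e split into three translates of those improper on A.

module Submission where

open import Algebra.Bundles using (CommutativeSemiring)

module FiniteSums {c ℓ} (R : CommutativeSemiring c ℓ) where

  open import Level using (Level)
  open import Data.Bool using (Bool; true; false; _∧_)
  open import Data.Nat using (ℕ; zero; suc)
  open import Data.Fin using (Fin; zero; suc)
  open import Data.List using (List; []; _∷_; _++_; map; concatMap; foldr; tabulate; allFin)
  open import Data.Bool.ListAction using (all)
  open import Function using (_∘_)
  import Data.Nat.Properties
  open import Defs using (allFuns)

  open CommutativeSemiring R hiding (zero)
  open import Algebra.Properties.Semiring.Sum semiring public using (sum; sum-syntax; sum-cong-≋; sum-replicate-zero; ∑-distrib-+)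
  open import Algebra.Properties.Semiring.Exp semiring public using (_^_; ^-homo-*)
  open import Algebra.Properties.CommutativeSemiring.Exp R public using (^-distrib-*)
  import Algebra.Properties.CommutativeMonoid.Sum *-commutativeMonoid as Product
  open import Relation.Binary.Reasoning.Setoid setoid
  open import Algebra.Properties.CommutativeSemigroup +-commutativeSemigroup using () renaming (interchange to +-interchange)
  import Algebra.Properties.Semiring.Sum Data.Nat.Properties.+-*-semiring as ℕSum

  ∏ : ∀ {n} → (Fin n → Carrier) → Carrier
  ∏ = Product.sum

  ∏-cong : ∀ {n} {f g : Fin n → Carrier} → (∀ i → f i ≈ g i) → ∏ f ≈ ∏ g
  ∏-cong = Product.sum-cong-≋

  ∏-distrib-* : ∀ {n} (f g : Fin n → Carrier) → ∏ (λ i → f i * g i) ≈ ∏ f * ∏ g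
  ∏-distrib-* = Product.∑-distrib-+

  ∏-1 : ∀ n → ∏ {n} (λ _ → 1#) ≈ 1#
  ∏-1 zero    = refl
  ∏-1 (suc n) = trans (*-identityˡ _) (∏-1 n)

  ∏-const : ∀ n x → ∏ {n} (λ _ → x) ≈ x ^ n
  ∏-const zero    x = refl
  ∏-const (suc n) x = *-congˡ (∏-const n x)

  1^≈1 : ∀ k → 1# ^ k ≈ 1#
  1^≈1 zero    = refl
  1^≈1 (suc k) = trans (*-identityˡ _) (1^≈1 k)

  ⟦_⟧ : Bool → Carrier
  ⟦ true ⟧  = 1#
  ⟦ false ⟧ = 0#

  ⟦∧⟧ : ∀ a b → ⟦ a ∧ b ⟧ ≈ ⟦ a ⟧ * ⟦ b ⟧
  ⟦∧⟧ true  b = sym (*-identityˡ ⟦ b ⟧)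
  ⟦∧⟧ false b = sym (zeroˡ ⟦ b ⟧)

  private variable
    a b : Level
    A : Set a
    B : Set b

  ∑ₗ : List A → (A → Carrier) → Carrier
  ∑ₗ xs f = foldr _+_ 0# (map f xs)

  syntax ∑ₗ xs (λ x → e) = ∑[ x ∈ xs ] e

  ∑ₗ-cong : ∀ (xs : List A) {f g : A → Carrier} → (∀ x → f x ≈ g x) → ∑ₗ xs f ≈ ∑ₗ xs g
  ∑ₗ-cong []       f≈g = refl
  ∑ₗ-cong (x ∷ xs) f≈g = +-cong (f≈g x) (∑ₗ-cong xs f≈g)

  ∑ₗ-++ : ∀ (xs ys : List A) f → ∑ₗ (xs ++ ys) f ≈ ∑ₗ xs f + ∑ₗ ys f
  ∑ₗ-++ []       ys f = sym (+-identityˡ _)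
  ∑ₗ-++ (x ∷ xs) ys f = trans (+-congˡ (∑ₗ-++ xs ys f)) (sym (+-assoc _ _ _))

  ∑ₗ-0 : ∀ (xs : List A) → ∑ₗ xs (λ _ → 0#) ≈ 0#
  ∑ₗ-0 []       = refl
  ∑ₗ-0 (x ∷ xs) = trans (+-identityˡ _) (∑ₗ-0 xs)

  ∑ₗ-distrib-+ : ∀ (xs : List A) f g → ∑ₗ xs (λ x → f x + g x) ≈ ∑ₗ xs f + ∑ₗ xs g
  ∑ₗ-distrib-+ []       f g = sym (+-identityˡ 0#)
  ∑ₗ-distrib-+ (x ∷ xs) f g =
    trans (+-congˡ (∑ₗ-distrib-+ xs f g)) (+-interchange (f x) (g x) (∑ₗ xs f) (∑ₗ xs g))

  *-distribˡ-∑ₗ : ∀ (xs : List A) k f → k * ∑ₗ xs f ≈ ∑ₗ xs (λ x → k * f x)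
  *-distribˡ-∑ₗ []       k f = zeroʳ k
  *-distribˡ-∑ₗ (x ∷ xs) k f = trans (distribˡ k (f x) _) (+-congˡ (*-distribˡ-∑ₗ xs k f))

  *-distribʳ-∑ₗ : ∀ (xs : List A) k f → ∑ₗ xs f * k ≈ ∑ₗ xs (λ x → f x * k)
  *-distribʳ-∑ₗ xs k f =
    trans (*-comm _ k) (trans (*-distribˡ-∑ₗ xs k f) (∑ₗ-cong xs (λ x → *-comm k (f x))))

  ∑ₗ-comm : ∀ (xs : List A) (ys : List B) (f : A → B → Carrier) →
            ∑[ x ∈ xs ] ∑[ y ∈ ys ] f x y ≈ ∑[ y ∈ ys ] ∑[ x ∈ xs ] f x y
  ∑ₗ-comm []       ys f = sym (∑ₗ-0 ys)
  ∑ₗ-comm (x ∷ xs) ys f =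
    trans (+-congˡ (∑ₗ-comm xs ys f)) (sym (∑ₗ-distrib-+ ys (f x) (λ y → ∑[ x′ ∈ xs ] f x′ y)))

  ∑ₗ-tabulate : ∀ {n} (g : Fin n → A) f → ∑ₗ (tabulate g) f ≈ ∑[ i < n ] f (g i)
  ∑ₗ-tabulate {n = zero}  g f = refl
  ∑ₗ-tabulate {n = suc n} g f = +-congˡ (∑ₗ-tabulate (g ∘ suc) f)

  ∑ₗ-map : ∀ (h : A → B) (xs : List A) f →
           ∑ₗ (map h xs) f ≈ ∑ₗ xs (f ∘ h)
  ∑ₗ-map h []       f = refl
  ∑ₗ-map h (x ∷ xs) f = +-congˡ (∑ₗ-map h xs f)

  ∑ₗ-concatMap : ∀ (h : A → List B) (xs : List A) f →
                 ∑ₗ (concatMap h xs) f ≈ ∑[ x ∈ xs ] ∑ₗ (h x) f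
  ∑ₗ-concatMap h []       f = refl
  ∑ₗ-concatMap h (x ∷ xs) f = trans (∑ₗ-++ (h x) _ f) (+-congˡ (∑ₗ-concatMap h xs f))

  ∑ₗ-allFin : ∀ n (f : Fin n → Carrier) → ∑ₗ (allFin n) f ≈ ∑[ i < n ] f i
  ∑ₗ-allFin n f = ∑ₗ-tabulate (λ i → i) f

  -- Expanding a product of sums: choosing one summand per factor is choosing a function.
  ∑-allFuns-∏ : ∀ n (bs : List B) (h : Fin n → B → Carrier) →
                ∑[ g ∈ allFuns n bs ] ∏ (λ v → h v (g v)) ≈ ∏ (λ v → ∑ₗ bs (h v))
  ∑-allFuns-∏ zero    bs h = +-identityʳ 1#
  ∑-allFuns-∏ (suc n) bs h = begin
    ∑ₗ (allFuns (suc n) bs) (λ g → ∏ (λ v → h v (g v)))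
      ≈⟨ ∑ₗ-concatMap _ bs _ ⟩
    ∑[ b ∈ bs ] ∑ₗ (map _ (allFuns n bs)) (λ g → ∏ (λ v → h v (g v)))
      ≈⟨ ∑ₗ-cong bs (λ b → ∑ₗ-map _ (allFuns n bs) _) ⟩
    ∑[ b ∈ bs ] ∑[ g ∈ allFuns n bs ] (h zero b * ∏ (λ v → h (suc v) (g v)))
      ≈⟨ ∑ₗ-cong bs (λ b → sym (*-distribˡ-∑ₗ (allFuns n bs) (h zero b) _)) ⟩
    ∑[ b ∈ bs ] (h zero b * ∑[ g ∈ allFuns n bs ] ∏ (λ v → h (suc v) (g v)))
      ≈⟨ ∑ₗ-cong bs (λ b → *-congˡ (∑-allFuns-∏ n bs (h ∘ suc))) ⟩
    ∑[ b ∈ bs ] (h zero b * ∏ (λ v → ∑ₗ bs (h (suc v))))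
      ≈⟨ sym (*-distribʳ-∑ₗ bs _ (h zero)) ⟩
    ∏ (λ v → ∑ₗ bs (h v)) ∎

  ⟦all-tabulate⟧ : ∀ {n} (p : A → Bool) (g : Fin n → A) →
                   ⟦ all p (tabulate g) ⟧ ≈ ∏ (λ i → ⟦ p (g i) ⟧)
  ⟦all-tabulate⟧ {n = zero}  p g = refl
  ⟦all-tabulate⟧ {n = suc n} p g = trans (⟦∧⟧ (p (g zero)) _) (*-congˡ (⟦all-tabulate⟧ p (g ∘ suc)))

  ⟦all-allFin⟧ : ∀ n (p : Fin n → Bool) → ⟦ all p (allFin n) ⟧ ≈ ∏ (λ i → ⟦ p i ⟧)
  ⟦all-allFin⟧ n p = ⟦all-tabulate⟧ p (λ i → i)

  ^-∑ : ∀ x {n} (f : Fin n → ℕ) → x ^ ℕSum.sum f ≈ ∏ (λ i → x ^ f i)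
  ^-∑ x {zero}  f = refl
  ^-∑ x {suc n} f = trans (^-homo-* x (f zero) _) (*-congˡ (^-∑ x (f ∘ suc)))

module Enumeration where

  open import Data.Bool using (Bool; true; false; _∧_; _∨_; not)
  open import Data.Nat using (ℕ; zero; suc; _+_; _*_; _≤_; _<_; z≤n; s≤s)
  open import Data.Nat.Properties using (+-*-commutativeSemiring; *-identityʳ; ≤-refl; +-mono-≤; +-mono-≤-<; m≤n⇒m≤1+n; <-cmp)
  open import Relation.Binary.Definitions using (tri<; tri≈; tri>)
  open import Function using (_∘_)
  open import Data.Fin using (Fin; zero; suc; toℕ)
  open import Data.Fin.Properties using (_≟_; toℕ-injective)
  open import Data.List using (List; []; _∷_; allFin; length)
  open import Data.List.Properties using (length-tabulate)
  open import Data.List.Relation.Unary.Any using (here; there)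
  open import Data.List.Membership.Propositional using (_∈_)
  open import Data.List.Membership.Propositional.Properties using (∈-allFin)
  open import Data.Bool.ListAction using (any; all)
  open import Data.Product using (_×_; _,_; ∃)
  open import Data.Empty using (⊥-elim)
  open import Relation.Nullary using (yes; no; ¬_)
  open import Relation.Binary.PropositionalEquality
  open import Defs using (count; allFuns; _==_)

  open FiniteSums +-*-commutativeSemiring public

  ==⇒≡ : ∀ {k} {a b : Fin k} → (a == b) ≡ true → a ≡ b
  ==⇒≡ {a = a} {b} eq with a ≟ b
  ... | yes a≡b = a≡b

  ==-refl : ∀ {k} (a : Fin k) → (a == a) ≡ true
  ==-refl a with a ≟ a
  ... | yes _  = refl
  ... | no a≢a = ⊥-elim (a≢a refl)

  ≢⇒==false : ∀ {k} {a b : Fin k} → ¬ a ≡ b → (a == b) ≡ false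
  ≢⇒==false {a = a} {b} a≢b with a ≟ b
  ... | yes a≡b = ⊥-elim (a≢b a≡b)
  ... | no _    = refl

  ==-sym : ∀ {k} (a b : Fin k) → (a == b) ≡ (b == a)
  ==-sym a b with a ≟ b | b ≟ a
  ... | yes _   | yes _   = refl
  ... | yes a≡b | no b≢a  = ⊥-elim (b≢a (sym a≡b))
  ... | no a≢b  | yes b≡a = ⊥-elim (a≢b (sym b≡a))
  ... | no _    | no _    = refl

  true≢false : true ≢ false
  true≢false ()

  ∧-true⁻ : ∀ {a b} → (a ∧ b) ≡ true → a ≡ true × b ≡ true
  ∧-true⁻ {true} {true} _ = refl , refl

  ∧-true⁺ : ∀ {a b} → a ≡ true → b ≡ true → (a ∧ b) ≡ true
  ∧-true⁺ refl refl = refl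

  ∨-true⁺ˡ : ∀ {a} b → a ≡ true → (a ∨ b) ≡ true
  ∨-true⁺ˡ b refl = refl

  ∨-true⁺ʳ : ∀ a {b} → b ≡ true → (a ∨ b) ≡ true
  ∨-true⁺ʳ true  refl = refl
  ∨-true⁺ʳ false refl = refl

  ≡true-ext : ∀ {a b} → (a ≡ true → b ≡ true) → (b ≡ true → a ≡ true) → a ≡ b
  ≡true-ext {true}  {true}  _ _ = refl
  ≡true-ext {true}  {false} a⇒b _ = sym (a⇒b refl)
  ≡true-ext {false} {true}  _ b⇒a = b⇒a refl
  ≡true-ext {false} {false} _ _ = refl

  module _ {a} {A : Set a} (p : A → Bool) where

    all⁻ : ∀ {xs x} → all p xs ≡ true → x ∈ xs → p x ≡ true
    all⁻ {x ∷ xs} h (here refl) with p x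
    ... | true = refl
    all⁻ {y ∷ xs} h (there x∈xs) with p y
    ... | true = all⁻ h x∈xs

    all⁺ : ∀ xs → (∀ {x} → x ∈ xs → p x ≡ true) → all p xs ≡ true
    all⁺ []       h = refl
    all⁺ (x ∷ xs) h rewrite h (here refl) = all⁺ xs (λ x∈xs → h (there x∈xs))

    all-false : ∀ xs → all p xs ≡ false → ∃ λ x → x ∈ xs × p x ≡ false
    all-false (x ∷ xs) h with p x in px
    ... | false = x , here refl , px
    ... | true with all-false xs h
    ... | y , y∈xs , py = y , there y∈xs , py

    any⁺ : ∀ {xs x} → x ∈ xs → p x ≡ true → any p xs ≡ true
    any⁺ (here refl) px rewrite px = refl
    any⁺ {y ∷ xs} (there x∈xs) px with p y
    ... | true  = refl
    ... | false = any⁺ x∈xs px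

    any⁻ : ∀ xs → any p xs ≡ true → ∃ λ x → x ∈ xs × p x ≡ true
    any⁻ (x ∷ xs) h with p x in px
    ... | true = x , here refl , px
    ... | false with any⁻ xs h
    ... | y , y∈xs , py = y , there y∈xs , py

  any-cong : ∀ {a} {A : Set a} {p q : A → Bool} → (∀ x → p x ≡ q x) → ∀ xs → any p xs ≡ any q xs
  any-cong p≡q []       = refl
  any-cong p≡q (x ∷ xs) = cong₂ _∨_ (p≡q x) (any-cong p≡q xs)

  all-cong : ∀ {a} {A : Set a} {p q : A → Bool} → (∀ x → p x ≡ q x) → ∀ xs → all p xs ≡ all q xs
  all-cong p≡q []       = refl
  all-cong p≡q (x ∷ xs) = cong₂ _∧_ (p≡q x) (all-cong p≡q xs)

  record Least {k} (p : Fin k → Bool) : Set where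
    constructor least
    field
      element : Fin k
      holds   : p element ≡ true
      minimal : ∀ u → toℕ u < toℕ element → p u ≡ false

  find-least : ∀ {k} (p : Fin k → Bool) w → p w ≡ true → Least p
  find-least {suc k} p w pw with p zero in p0
  ... | true = least zero p0 (λ u ())
  find-least {suc k} p zero    pw | false = ⊥-elim (true≢false (trans (sym pw) p0))
  find-least {suc k} p (suc w) pw | false with find-least (p ∘ suc) w pw
  ... | least u pu min = least (suc u) pu λ { zero _ → p0 ; (suc u′) (s≤s u′<u) → min u′ u′<u }

  least-unique : ∀ {k} {p q : Fin k → Bool} → (∀ x → p x ≡ q x) →
                 (L₁ : Least p) (L₂ : Least q) → Least.element L₁ ≡ Least.element L₂
  least-unique p≡q (least u₁ p₁ min₁) (least u₂ p₂ min₂) with <-cmp (toℕ u₁) (toℕ u₂)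
  ... | tri≈ _ u₁≡u₂ _ = toℕ-injective u₁≡u₂
  ... | tri< u₁<u₂ _ _ = ⊥-elim (true≢false (trans (sym (trans (sym (p≡q u₁)) p₁)) (min₂ u₁ u₁<u₂)))
  ... | tri> _ _ u₂<u₁ = ⊥-elim (true≢false (trans (sym (trans (p≡q u₂) p₂)) (min₁ u₂ u₂<u₁)))

  count≡∑ : ∀ {A : Set} (p : A → Bool) xs → count p xs ≡ ∑[ x ∈ xs ] ⟦ p x ⟧
  count≡∑ p []       = refl
  count≡∑ p (x ∷ xs) with p x
  ... | true  = cong suc (count≡∑ p xs)
  ... | false = count≡∑ p xs

  ⟦⟧-split : ∀ a b → ⟦ a ⟧ ≡ ⟦ a ∧ not b ⟧ + ⟦ a ∧ b ⟧
  ⟦⟧-split true  true  = refl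
  ⟦⟧-split true  false = refl
  ⟦⟧-split false _     = refl

  ∑⟦⟧≡0 : ∀ k (p : Fin k → Bool) → ∑[ i < k ] ⟦ p i ⟧ ≡ 0 → ∀ i → p i ≡ false
  ∑⟦⟧≡0 (suc k) p h i with p zero in p0
  ∑⟦⟧≡0 (suc k) p h zero    | false = p0
  ∑⟦⟧≡0 (suc k) p h (suc i) | false = ∑⟦⟧≡0 k (p ∘ suc) h i

  length≡∑ : ∀ {a} {A : Set a} (xs : List A) → length xs ≡ ∑[ x ∈ xs ] 1
  length≡∑ []       = refl
  length≡∑ (x ∷ xs) = cong suc (length≡∑ xs)

  ∑-allFin-1 : ∀ k → ∑[ i ∈ allFin k ] 1 ≡ k
  ∑-allFin-1 k = trans (sym (length≡∑ (allFin k))) (length-tabulate (λ i → i))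

  count-allFin : ∀ n (p : Fin n → Bool) → count p (allFin n) ≡ ∑[ i < n ] ⟦ p i ⟧
  count-allFin n p = trans (count≡∑ p (allFin n)) (∑ₗ-allFin n _)

  count-cong : ∀ {A : Set} {p q : A → Bool} xs → (∀ x → p x ≡ q x) → count p xs ≡ count q xs
  count-cong {p = p} {q} xs p≡q =
    trans (count≡∑ p xs) (trans (∑ₗ-cong xs (λ x → cong ⟦_⟧ (p≡q x))) (sym (count≡∑ q xs)))

  count-pos : ∀ {A : Set} (p : A → Bool) xs → 0 < count p xs → ∃ λ x → p x ≡ true
  count-pos p (x ∷ xs) pos with p x in px
  ... | true  = x , px
  ... | false = count-pos p xs pos

  ∑-==ˡ : ∀ n (a : Fin n) → ∑[ i < n ] ⟦ a == i ⟧ ≡ 1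
  ∑-==ˡ (suc n) zero    =
    cong suc (trans (sum-cong-≋ {n} (λ i → cong ⟦_⟧ (≢⇒==false {a = zero} {suc i} λ ()))) (sum-replicate-zero n))
  ∑-==ˡ (suc n) (suc a) =
    trans (cong₂ _+_ (cong ⟦_⟧ (≢⇒==false {a = suc a} {zero} λ ())) (sum-cong-≋ {n} (λ i → cong ⟦_⟧ (suc==suc a i))))
          (∑-==ˡ n a)
    where
    suc==suc : ∀ {k} (a i : Fin k) → (suc a == suc i) ≡ (a == i)
    suc==suc a i with a ≟ i
    ... | yes _ = refl
    ... | no _  = refl

  ⟦⟧-partition : ∀ {k} a (x : Fin k) → ⟦ a ⟧ ≡ ∑[ c ∈ allFin k ] ⟦ a ∧ (x == c) ⟧
  ⟦⟧-partition {k} a x = begin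
    ⟦ a ⟧                                      ≡⟨ sym (*-identityʳ _) ⟩
    ⟦ a ⟧ * 1                                  ≡⟨ cong (⟦ a ⟧ *_) (sym (trans (∑ₗ-allFin k _) (∑-==ˡ k x))) ⟩
    ⟦ a ⟧ * ∑[ c ∈ allFin k ] ⟦ x == c ⟧        ≡⟨ *-distribˡ-∑ₗ (allFin k) ⟦ a ⟧ _ ⟩
    ∑[ c ∈ allFin k ] (⟦ a ⟧ * ⟦ x == c ⟧)      ≡⟨ ∑ₗ-cong (allFin k) (λ c → sym (⟦∧⟧ a (x == c))) ⟩
    ∑[ c ∈ allFin k ] ⟦ a ∧ (x == c) ⟧          ∎
    where open ≡-Reasoning

  ⟦⟧-mono : ∀ {a b} → (a ≡ true → b ≡ true) → ⟦ a ⟧ ≤ ⟦ b ⟧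
  ⟦⟧-mono {true}  a⇒b rewrite a⇒b refl = ≤-refl
  ⟦⟧-mono {false} a⇒b = z≤n

  ∑⟦⟧-mono : ∀ k {p q : Fin k → Bool} → (∀ i → p i ≡ true → q i ≡ true) →
             ∑[ i < k ] ⟦ p i ⟧ ≤ ∑[ i < k ] ⟦ q i ⟧
  ∑⟦⟧-mono zero    p⇒q = z≤n
  ∑⟦⟧-mono (suc k) p⇒q = +-mono-≤ (⟦⟧-mono (p⇒q zero)) (∑⟦⟧-mono k (p⇒q ∘ suc))

  ∑⟦⟧-mono-< : ∀ k {p q : Fin k → Bool} → (∀ i → p i ≡ true → q i ≡ true) →
               ∀ j → p j ≡ false → q j ≡ true → ∑[ i < k ] ⟦ p i ⟧ < ∑[ i < k ] ⟦ q i ⟧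
  ∑⟦⟧-mono-< (suc k) {p} {q} p⇒q zero    pj qj rewrite pj | qj = s≤s (∑⟦⟧-mono k (p⇒q ∘ suc))
  ∑⟦⟧-mono-< (suc k)         p⇒q (suc j) pj qj =
    +-mono-≤-< (⟦⟧-mono (p⇒q zero)) (∑⟦⟧-mono-< k (p⇒q ∘ suc) j pj qj)

  ∑⟦⟧≤ : ∀ k (p : Fin k → Bool) → ∑[ i < k ] ⟦ p i ⟧ ≤ k
  ∑⟦⟧≤ zero    p = z≤n
  ∑⟦⟧≤ (suc k) p with p zero
  ... | true  = s≤s (∑⟦⟧≤ k (p ∘ suc))
  ... | false = m≤n⇒m≤1+n (∑⟦⟧≤ k (p ∘ suc))

  ∑ₗ-mono : ∀ {a} {A : Set a} (xs : List A) {f g : A → ℕ} → (∀ x → f x ≤ g x) → ∑ₗ xs f ≤ ∑ₗ xs g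
  ∑ₗ-mono []       f≤g = z≤n
  ∑ₗ-mono (x ∷ xs) f≤g = +-mono-≤ (f≤g x) (∑ₗ-mono xs f≤g)

  module FunctionCounting (n m : ℕ) where

    Fun : Set
    Fun = Fin n → Fin m

    funs : List Fun
    funs = allFuns n (allFin m)

    _≐_ : Fun → Fun → Bool
    h ≐ g = all (λ v → h v == g v) (allFin n)

    ≐⇒≗ : ∀ {h g} → (h ≐ g) ≡ true → ∀ v → h v ≡ g v
    ≐⇒≗ h≐g v = ==⇒≡ (all⁻ _ h≐g (∈-allFin v))

    ≗⇒≐ : ∀ {h g} → (∀ v → h v ≡ g v) → (h ≐ g) ≡ true
    ≗⇒≐ {h} h≗g = all⁺ _ (allFin n) (λ {v} _ → subst (λ x → (h v == x) ≡ true) (h≗g v) (==-refl (h v)))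

    ∑-≐ : ∀ h → ∑[ g ∈ funs ] ⟦ h ≐ g ⟧ ≡ 1
    ∑-≐ h = begin
      ∑[ g ∈ funs ] ⟦ h ≐ g ⟧                         ≡⟨ ∑ₗ-cong funs (λ g → ⟦all-allFin⟧ n _) ⟩
      ∑[ g ∈ funs ] ∏ (λ v → ⟦ h v == g v ⟧)          ≡⟨ ∑-allFuns-∏ n (allFin m) (λ v b → ⟦ h v == b ⟧) ⟩
      ∏ (λ v → ∑[ b ∈ allFin m ] ⟦ h v == b ⟧)        ≡⟨ ∏-cong (λ v → trans (∑ₗ-allFin m _) (∑-==ˡ m (h v))) ⟩
      ∏ {n} (λ _ → 1)                                 ≡⟨ ∏-1 n ⟩
      1                                               ∎
      where open ≡-Reasoning

    count-funs : count (λ _ → true) funs ≡ m ^ n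
    count-funs = begin
      count (λ _ → true) funs              ≡⟨ count≡∑ _ funs ⟩
      ∑[ g ∈ funs ] 1                      ≡⟨ ∑ₗ-cong funs (λ _ → sym (∏-1 n)) ⟩
      ∑[ g ∈ funs ] ∏ {n} (λ _ → 1)        ≡⟨ ∑-allFuns-∏ n (allFin m) (λ _ _ → 1) ⟩
      ∏ {n} (λ _ → ∑[ b ∈ allFin m ] 1)   ≡⟨ ∏-cong {n} (λ _ → ∑-allFin-1 m) ⟩
      ∏ {n} (λ _ → m)                      ≡⟨ ∏-const n m ⟩
      m ^ n                                ∎
      where open ≡-Reasoning

    count-via : ∀ (P : Fun → Bool) (h : Fun → Fun) →
                count P funs ≡ ∑[ f ∈ funs ] ∑[ g ∈ funs ] ⟦ P f ∧ (h f ≐ g) ⟧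
    count-via P h = trans (count≡∑ P funs) (∑ₗ-cong funs λ f → begin
      ⟦ P f ⟧                                     ≡⟨ sym (*-identityʳ _) ⟩
      ⟦ P f ⟧ * 1                                 ≡⟨ cong (⟦ P f ⟧ *_) (sym (∑-≐ (h f))) ⟩
      ⟦ P f ⟧ * ∑[ g ∈ funs ] ⟦ h f ≐ g ⟧          ≡⟨ *-distribˡ-∑ₗ funs ⟦ P f ⟧ (λ g → ⟦ h f ≐ g ⟧) ⟩
      ∑[ g ∈ funs ] (⟦ P f ⟧ * ⟦ h f ≐ g ⟧)        ≡⟨ ∑ₗ-cong funs (λ g → sym (⟦∧⟧ (P f) _)) ⟩
      ∑[ g ∈ funs ] ⟦ P f ∧ (h f ≐ g) ⟧            ∎)
      where open ≡-Reasoning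

    -- Functions are only ever compared pointwise, so the maps need only be inverse up to ≗.
    record CountingBijection (P Q : Fun → Bool) : Set where
      field
        to from   : Fun → Fun
        P-resp    : ∀ {f f′} → (∀ v → f v ≡ f′ v) → P f ≡ P f′
        Q-resp    : ∀ {g g′} → (∀ v → g v ≡ g′ v) → Q g ≡ Q g′
        to-resp   : ∀ {f f′} → (∀ v → f v ≡ f′ v) → ∀ v → to f v ≡ to f′ v
        from-resp : ∀ {g g′} → (∀ v → g v ≡ g′ v) → ∀ v → from g v ≡ from g′ v
        to-Q      : ∀ f → P f ≡ true → Q (to f) ≡ true
        from-P    : ∀ g → Q g ≡ true → P (from g) ≡ true
        from∘to   : ∀ f → P f ≡ true → ∀ v → from (to f) v ≡ f v
        to∘from   : ∀ g → Q g ≡ true → ∀ v → to (from g) v ≡ g v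

    count-bijection : ∀ {P Q} → CountingBijection P Q → count P funs ≡ count Q funs
    count-bijection {P} {Q} bij = begin
      count P funs                                        ≡⟨ count-via P to ⟩
      ∑[ f ∈ funs ] ∑[ g ∈ funs ] ⟦ P f ∧ (to f ≐ g) ⟧      ≡⟨ ∑ₗ-comm funs funs _ ⟩
      ∑[ g ∈ funs ] ∑[ f ∈ funs ] ⟦ P f ∧ (to f ≐ g) ⟧      ≡⟨ ∑ₗ-cong funs (λ g → ∑ₗ-cong funs (λ f → cong ⟦_⟧ (pairs f g))) ⟩
      ∑[ g ∈ funs ] ∑[ f ∈ funs ] ⟦ Q g ∧ (from g ≐ f) ⟧    ≡⟨ sym (count-via Q from) ⟩
      count Q funs                                        ∎
      where
      open ≡-Reasoning
      open CountingBijection bij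
      pairs : ∀ f g → (P f ∧ (to f ≐ g)) ≡ (Q g ∧ (from g ≐ f))
      pairs f g = ≡true-ext
        (λ h → let pf , f↦g = ∧-true⁻ h ; to-f≗g = ≐⇒≗ f↦g in
          ∧-true⁺ (trans (sym (Q-resp to-f≗g)) (to-Q f pf))
                  (≗⇒≐ λ v → trans (sym (from-resp to-f≗g v)) (from∘to f pf v)))
        (λ h → let qg , g↦f = ∧-true⁻ h ; from-g≗f = ≐⇒≗ g↦f in
          ∧-true⁺ (trans (sym (P-resp from-g≗f)) (from-P g qg))
                  (≗⇒≐ λ v → trans (sym (to-resp from-g≗f v)) (to∘from g qg v)))

module Connectivity where

  open import Data.Bool using (Bool; true; false; _∧_; _∨_; not; if_then_else_)
  open import Data.Bool.Properties using (∧-assoc; ∨-assoc; ∨-comm; ∨-idem; ∧-identityʳ; not-injective)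
  open import Data.Nat using (ℕ; zero; suc; _+_; _≤_; _<_; s≤s; _∸_; _<?_)
  open import Data.Nat.Properties using (≤-refl; ≤-trans; ≤-reflexive; m≤n⇒m≤1+n; m∸n+n≡m; m≤m+n; <⇒≱; <-cmp)
  open import Data.Fin using (Fin; zero; suc; toℕ)
  open import Data.Fin.Properties using (toℕ-injective)
  open import Data.List using (List; []; _∷_; _++_; length; allFin)
  open import Data.List.Membership.Propositional.Properties using (∈-allFin)
  open import Data.Bool.ListAction using (any; all)
  open import Data.Product using (_×_; _,_; proj₁; proj₂; ∃)
  open import Data.Sum using (_⊎_; inj₁; inj₂)
  open import Data.Empty using (⊥-elim)
  open import Relation.Nullary using (yes; no)
  open import Relation.Nullary.Decidable using (⌊_⌋)
  open import Relation.Binary.Definitions using (tri<; tri≈; tri>)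
  open import Relation.Binary.PropositionalEquality
  open import Defs
  open Enumeration

  _·_ : Sign → Sign → Sign
  a · b = if a then b else not b

  ·-identityʳ : ∀ a → a · true ≡ a
  ·-identityʳ true  = refl
  ·-identityʳ false = refl

  ·-comm : ∀ a b → a · b ≡ b · a
  ·-comm true  true  = refl
  ·-comm true  false = refl
  ·-comm false true  = refl
  ·-comm false false = refl

  ·-assoc : ∀ a b c → a · (b · c) ≡ (a · b) · c
  ·-assoc true  b     c     = refl
  ·-assoc false true  c     = refl
  ·-assoc false false true  = refl
  ·-assoc false false false = refl

  ·-cancelˡ : ∀ a b → a · (a · b) ≡ b
  ·-cancelˡ true  b     = refl
  ·-cancelˡ false true  = refl
  ·-cancelˡ false false = refl

  module Walks {n : ℕ} (Σ : SignedGraph n) (A : EdgeSet Σ) where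

    Steps : Set
    Steps = List (Fin n × Edge Σ)

    -- As in Defs.linked, the steps (v₀ , e₁) ∷ … ending at w describe a walk from v₀ to w.
    start : Fin n → Steps → Fin n
    start w []            = w
    start w ((v , _) ∷ _) = v

    inA : Steps → Bool
    inA = all (λ p → A (proj₂ p))

    start-++ : ∀ w xs ys → start w (xs ++ ys) ≡ start (start w ys) xs
    start-++ w []       ys = refl
    start-++ w (x ∷ xs) ys = refl

    signProduct-++ : ∀ xs ys → signProduct Σ (xs ++ ys) ≡ signProduct Σ xs · signProduct Σ ys
    signProduct-++ []             ys = refl
    signProduct-++ ((v , e) ∷ xs) ys =
      trans (cong (sign Σ e ·_) (signProduct-++ xs ys)) (·-assoc (sign Σ e) _ _)

    linked-++ : ∀ w xs ys → linked Σ w (xs ++ ys) ≡ (linked Σ (start w ys) xs ∧ linked Σ w ys)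
    linked-++ w []                       ys              = refl
    linked-++ w ((v , e) ∷ [])           []              = sym (∧-identityʳ _)
    linked-++ w ((v , e) ∷ [])           ((u , f) ∷ ys) = refl
    linked-++ w ((v , e) ∷ (v′ , e′) ∷ xs) ys =
      trans (cong (joins Σ e v v′ ∧_) (linked-++ w ((v′ , e′) ∷ xs) ys)) (sym (∧-assoc (joins Σ e v v′) _ _))

    linked-∷ : ∀ w v e xs → linked Σ w ((v , e) ∷ xs) ≡ (joins Σ e v (start w xs) ∧ linked Σ w xs)
    linked-∷ w v e xs = linked-++ w ((v , e) ∷ []) xs

    inA-++ : ∀ xs ys → inA (xs ++ ys) ≡ (inA xs ∧ inA ys)
    inA-++ []       ys = refl
    inA-++ (x ∷ xs) ys = trans (cong (A (proj₂ x) ∧_) (inA-++ xs ys)) (sym (∧-assoc (A (proj₂ x)) _ _))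

    joins-sym : ∀ e u v → joins Σ e u v ≡ joins Σ e v u
    joins-sym e u v = ∨-comm (ends₁ Σ e == u ∧ ends₂ Σ e == v) (ends₁ Σ e == v ∧ ends₂ Σ e == u)

    joins⇒ends : ∀ e u v → joins Σ e u v ≡ true →
                 (ends₁ Σ e ≡ u × ends₂ Σ e ≡ v) ⊎ (ends₁ Σ e ≡ v × ends₂ Σ e ≡ u)
    joins⇒ends e u v h with ends₁ Σ e == u in e₁u | ends₂ Σ e == v in e₂v
    ... | true  | true  = inj₁ (==⇒≡ e₁u , ==⇒≡ e₂v)
    ... | true  | false = inj₂ (let p , q = ∧-true⁻ h in ==⇒≡ p , ==⇒≡ q)
    ... | false | _     = inj₂ (let p , q = ∧-true⁻ h in ==⇒≡ p , ==⇒≡ q)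

    record Walk (v w : Fin n) : Set where
      constructor walk
      field
        steps  : Steps
        starts : start w steps ≡ v
        chain  : linked Σ w steps ≡ true
        inside : inA steps ≡ true

    open Walk public

    walkSign : ∀ {v w} → Walk v w → Sign
    walkSign W = signProduct Σ (steps W)

    []ʷ : ∀ v → Walk v v
    []ʷ v = walk [] refl refl refl

    _++ʷ_ : ∀ {u v w} → Walk u v → Walk v w → Walk u w
    _++ʷ_ {w = w} (walk xs s c i) (walk ys s′ c′ i′) = walk (xs ++ ys)
      (trans (start-++ w xs ys) (trans (cong (λ z → start z xs) s′) s))
      (trans (linked-++ w xs ys) (∧-true⁺ (trans (cong (λ z → linked Σ z xs) s′) c) c′))
      (trans (inA-++ xs ys) (∧-true⁺ i i′))

    edgeʷ : ∀ {u w} e → A e ≡ true → joins Σ e u w ≡ true → Walk u w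
    edgeʷ {u} e Ae j = walk ((u , e) ∷ []) refl j (trans (∧-identityʳ _) Ae)

    walkSign-++ : ∀ {u v w} (W₁ : Walk u v) (W₂ : Walk v w) →
                  walkSign (W₁ ++ʷ W₂) ≡ walkSign W₁ · walkSign W₂
    walkSign-++ W₁ W₂ = signProduct-++ (steps W₁) (steps W₂)

    walkSign-edge : ∀ {u w} e Ae j → walkSign (edgeʷ {u} {w} e Ae j) ≡ sign Σ e
    walkSign-edge e Ae j = ·-identityʳ (sign Σ e)

    private
      rev : Fin n → Steps → Steps
      rev w []             = []
      rev w ((v , e) ∷ xs) = rev w xs ++ ((start w xs , e) ∷ [])

      rev-start : ∀ w xs → start (start w xs) (rev w xs) ≡ w
      rev-start w []             = refl
      rev-start w ((v , e) ∷ xs) = trans (start-++ v (rev w xs) _) (rev-start w xs)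

      rev-chain : ∀ w xs → linked Σ w xs ≡ true → linked Σ (start w xs) (rev w xs) ≡ true
      rev-chain w []             _ = refl
      rev-chain w ((v , e) ∷ xs) c =
        let j , c′ = ∧-true⁻ (trans (sym (linked-∷ w v e xs)) c) in
        trans (linked-++ v (rev w xs) _) (∧-true⁺ (rev-chain w xs c′) (trans (joins-sym e _ _) j))

      rev-inA : ∀ w xs → inA xs ≡ true → inA (rev w xs) ≡ true
      rev-inA w []             _ = refl
      rev-inA w ((v , e) ∷ xs) i =
        let Ae , i′ = ∧-true⁻ i in
        trans (inA-++ (rev w xs) _) (∧-true⁺ (rev-inA w xs i′) (trans (∧-identityʳ _) Ae))

      rev-sign : ∀ w xs → signProduct Σ (rev w xs) ≡ signProduct Σ xs
      rev-sign w []             = refl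
      rev-sign w ((v , e) ∷ xs) =
        trans (signProduct-++ (rev w xs) _)
              (trans (cong₂ _·_ (rev-sign w xs) (·-identityʳ (sign Σ e))) (·-comm (signProduct Σ xs) (sign Σ e)))

    reverseʷ : ∀ {v w} → Walk v w → Walk w v
    reverseʷ {w = w} (walk xs refl c i) = walk (rev w xs) (rev-start w xs) (rev-chain w xs c) (rev-inA w xs i)

    walkSign-reverse : ∀ {v w} (W : Walk v w) → walkSign (reverseʷ W) ≡ walkSign W
    walkSign-reverse {w = w} (walk xs refl _ _) = rev-sign w xs

    Reach : ℕ → Fin n → Fin n → Bool
    Reach = reachWithin Σ A

    reach-suc : ∀ i {v w} → Reach i v w ≡ true → Reach (suc i) v w ≡ true
    reach-suc i r = ∨-true⁺ˡ _ r

    reach-mono : ∀ d i {v w} → Reach i v w ≡ true → Reach (d + i) v w ≡ true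
    reach-mono zero    i r = r
    reach-mono (suc d) i r = reach-suc (d + i) (reach-mono d i r)

    reach-step : ∀ i {v u w} e → Reach i v u ≡ true → A e ≡ true → joins Σ e u w ≡ true → Reach (suc i) v w ≡ true
    reach-step i {v} {u} {w} e r Ae j =
      ∨-true⁺ʳ (Reach i v w) (any⁺ _ (∈-allFin u) (∧-true⁺ r (any⁺ _ (∈-allFin e) (∧-true⁺ Ae j))))

    reach-suc⁻ : ∀ i {v w} → Reach (suc i) v w ≡ true →
                 Reach i v w ≡ true ⊎ ∃ λ u → ∃ λ e → Reach i v u ≡ true × A e ≡ true × joins Σ e u w ≡ true
    reach-suc⁻ i {v} {w} r with Reach i v w in r′
    ... | true  = inj₁ refl
    ... | false with any⁻ _ (allFin n) r
    ... | u , _ , p with ∧-true⁻ p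
    ... | vu , uw with any⁻ _ (allFin (nE Σ)) uw
    ... | e , _ , q = let Ae , j = ∧-true⁻ q in inj₂ (u , e , vu , Ae , j)

    reach-∷ : ∀ i {v u w} e → A e ≡ true → joins Σ e v u ≡ true → Reach i u w ≡ true → Reach (suc i) v w ≡ true
    reach-∷ zero    {v} e Ae j r with ==⇒≡ r
    ... | refl = reach-step 0 e (==-refl v) Ae j
    reach-∷ (suc i) e Ae j r with reach-suc⁻ i r
    ... | inj₁ uw                    = reach-suc (suc i) (reach-∷ i e Ae j uw)
    ... | inj₂ (x , f , ux , Af , k) = reach-step (suc i) f (reach-∷ i e Ae j ux) Af k

    walk⇒reach : ∀ {v w} (W : Walk v w) → Reach (length (steps W)) v w ≡ true
    walk⇒reach {w = w} (walk xs refl c i) = go xs c i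
      where
      go : ∀ xs → linked Σ w xs ≡ true → inA xs ≡ true → Reach (length xs) (start w xs) w ≡ true
      go []             _ _ = ==-refl w
      go ((v , e) ∷ xs) c i =
        let j , c′ = ∧-true⁻ (trans (sym (linked-∷ w v e xs)) c) ; Ae , i′ = ∧-true⁻ i in
        reach-∷ (length xs) e Ae j (go xs c′ i′)

    reach⇒walk : ∀ i {v w} → Reach i v w ≡ true → Walk v w
    reach⇒walk zero    {v} r with ==⇒≡ r
    ... | refl = []ʷ v
    reach⇒walk (suc i) r with reach-suc⁻ i r
    ... | inj₁ vw                   = reach⇒walk i vw
    ... | inj₂ (u , e , vu , Ae , j) = reach⇒walk i vu ++ʷ edgeʷ e Ae j

    Stable : Fin n → ℕ → Set
    Stable v i = ∀ w → Reach (suc i) v w ≡ Reach i v w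

    stable-suc : ∀ {v i} → Stable v i → Stable v (suc i)
    stable-suc {v} {i} st w =
      trans (cong (Reach (suc i) v w ∨_) (any-cong (λ u → cong (_∧ adj Σ A u w) (st u)) (allFin n)))
            (trans (∨-assoc (Reach i v w) b b) (cong (Reach i v w ∨_) (∨-idem b)))
      where b = any (λ u → Reach i v u ∧ adj Σ A u w) (allFin n)

    stable-+ : ∀ {v i} → Stable v i → ∀ d w → Reach (d + i) v w ≡ Reach i v w
    stable-+ {v} {i} st zero    w = refl
    stable-+ {v} {i} st (suc d) w = trans (stable-from d w) (stable-+ st d w)
      where
      stable-from : ∀ d → Stable v (d + i)
      stable-from zero    = st
      stable-from (suc d) = stable-suc {v} {d + i} (stable-from d)

    -- Until it stabilises, the set reached from v grows by at least one vertex per step.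
    stabilises : ∀ v i → (∃ λ j → j ≤ i × Stable v j) ⊎ (suc i ≤ ∑[ w < n ] ⟦ Reach i v w ⟧)
    stabilises v zero = inj₂ (≤-reflexive (sym (∑-==ˡ n v)))
    stabilises v (suc i) with stabilises v i
    ... | inj₁ (j , j≤i , st) = inj₁ (j , m≤n⇒m≤1+n j≤i , st)
    ... | inj₂ grows with all (λ w → not (Reach (suc i) v w) ∨ Reach i v w) (allFin n) in none-new
    ... | true  = inj₁ (i , m≤n⇒m≤1+n ≤-refl , λ w →
        ≡true-ext (old (all⁻ _ none-new (∈-allFin w))) (reach-suc i))
      where
      old : ∀ {a b} → (not a ∨ b) ≡ true → a ≡ true → b ≡ true
      old {true} b refl = b
    ... | false with all-false _ (allFin n) none-new
    ... | w , _ , new = inj₂ (≤-trans (s≤s grows) (∑⟦⟧-mono-< n (λ u → reach-suc i) w (proj₂ (fresh new)) (proj₁ (fresh new))))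
      where
      fresh : ∀ {a b} → (not a ∨ b) ≡ false → a ≡ true × b ≡ false
      fresh {true} {false} _ = refl , refl

    reach-saturates : ∀ i {v w} → Reach i v w ≡ true → Reach n v w ≡ true
    reach-saturates i {v} {w} r with stabilises v n
    ... | inj₂ n<count = ⊥-elim (<⇒≱ n<count (∑⟦⟧≤ n (Reach n v)))
    ... | inj₁ (j , j≤n , st) =
      trans (stable-at n j≤n) (trans (sym (stable-at (n + i) (≤-trans j≤n (m≤m+n n i)))) (reach-mono n i r))
      where
      stable-at : ∀ k → j ≤ k → Reach k v w ≡ Reach j v w
      stable-at k j≤k = trans (cong (λ z → Reach z v w) (sym (m∸n+n≡m j≤k))) (stable-+ st (k ∸ j) w)

    Connected : Fin n → Fin n → Bool
    Connected = sameComp Σ A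

    walk⇒connected : ∀ {v w} → Walk v w → Connected v w ≡ true
    walk⇒connected W = reach-saturates (length (steps W)) (walk⇒reach W)

    connected⇒walk : ∀ {v w} → Connected v w ≡ true → Walk v w
    connected⇒walk = reach⇒walk n

    connected-refl : ∀ v → Connected v v ≡ true
    connected-refl v = walk⇒connected ([]ʷ v)

    connected-sym : ∀ {v w} → Connected v w ≡ true → Connected w v ≡ true
    connected-sym c = walk⇒connected (reverseʷ (connected⇒walk c))

    connected-trans : ∀ {u v w} → Connected u v ≡ true → Connected v w ≡ true → Connected u w ≡ true
    connected-trans c c′ = walk⇒connected (connected⇒walk c ++ʷ connected⇒walk c′)

    connected-cong : ∀ {a b} → Connected a b ≡ true → ∀ x → Connected x a ≡ Connected x b
    connected-cong ab x = ≡true-ext (λ xa → connected-trans xa ab) (λ xb → connected-trans xb (connected-sym ab))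

    isRep⇒minimal : ∀ v → isRep Σ A v ≡ true → ∀ u → toℕ u < toℕ v → Connected u v ≡ false
    isRep⇒minimal v r u u<v with toℕ u <? toℕ v | all⁻ _ r (∈-allFin u)
    ... | no u≮v | _ = ⊥-elim (u≮v u<v)
    ... | yes _  | h = not-injective h

    minimal⇒isRep : ∀ v → (∀ u → toℕ u < toℕ v → Connected u v ≡ false) → isRep Σ A v ≡ true
    minimal⇒isRep v min = all⁺ _ (allFin n) λ {u} _ → at u
      where
      at : ∀ u → not (⌊ toℕ u <? toℕ v ⌋ ∧ Connected u v) ≡ true
      at u with toℕ u <? toℕ v
      ... | yes u<v rewrite min u u<v = refl
      ... | no _    = refl

    private
      leastInComponent : ∀ w → Least (λ u → Connected u w)
      leastInComponent w = find-least _ w (connected-refl w)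

    rep : Fin n → Fin n
    rep w = Least.element (leastInComponent w)

    rep-connected : ∀ w → Connected (rep w) w ≡ true
    rep-connected w = Least.holds (leastInComponent w)

    rep-isRep : ∀ w → isRep Σ A (rep w) ≡ true
    rep-isRep w = minimal⇒isRep (rep w) λ u u<rep →
      trans (connected-cong (rep-connected w) u) (Least.minimal (leastInComponent w) u u<rep)

    isRep⇒rep≡ : ∀ v → isRep Σ A v ≡ true → rep v ≡ v
    isRep⇒rep≡ v r with <-cmp (toℕ (rep v)) (toℕ v)
    ... | tri≈ _ rep≡v _ = toℕ-injective rep≡v
    ... | tri< rep<v _ _ = ⊥-elim (true≢false (trans (sym (rep-connected v)) (isRep⇒minimal v r (rep v) rep<v)))
    ... | tri> _ _ v<rep = ⊥-elim (true≢false (trans (sym (connected-refl v)) (Least.minimal (leastInComponent v) v v<rep)))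

    rep-cong : ∀ {a b} → Connected a b ≡ true → rep a ≡ rep b
    rep-cong ab = least-unique (connected-cong ab) (leastInComponent _) (leastInComponent _)

  module ComponentCounts {n : ℕ} (Σ : SignedGraph n) where

    kc≡kb+ku : ∀ A → kc Σ A ≡ kb Σ A + ku Σ A
    kc≡kb+ku A = begin
      kc Σ A                                               ≡⟨ count-allFin n _ ⟩
      ∑[ v < n ] ⟦ isRep Σ A v ⟧                            ≡⟨ sum-cong-≋ (λ v → ⟦⟧-split (isRep Σ A v) (compUnbalanced Σ A v)) ⟩
      ∑[ v < n ] (⟦ isRep Σ A v ∧ not (compUnbalanced Σ A v) ⟧ + ⟦ isRep Σ A v ∧ compUnbalanced Σ A v ⟧)
                                                           ≡⟨ ∑-distrib-+ (λ v → ⟦ isRep Σ A v ∧ not (compUnbalanced Σ A v) ⟧) _ ⟩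
      ∑[ v < n ] ⟦ isRep Σ A v ∧ not (compUnbalanced Σ A v) ⟧ + ∑[ v < n ] ⟦ isRep Σ A v ∧ compUnbalanced Σ A v ⟧
                                                           ≡⟨ sym (cong₂ _+_ (count-allFin n _) (count-allFin n _)) ⟩
      kb Σ A + ku Σ A                                      ∎
      where open ≡-Reasoning

    kc≤n : ∀ A → kc Σ A ≤ n
    kc≤n A = subst (_≤ n) (sym (count-allFin n _)) (∑⟦⟧≤ n (isRep Σ A))

    reach-⊆ : ∀ {A B} → (∀ e → A e ≡ true → B e ≡ true) →
              ∀ i {v w} → reachWithin Σ A i v w ≡ true → reachWithin Σ B i v w ≡ true
    reach-⊆ A⊆B zero    r = r
    reach-⊆ {A} {B} A⊆B (suc i) r with Walks.reach-suc⁻ Σ A i r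
    ... | inj₁ vw                   = ∨-true⁺ˡ _ (reach-⊆ A⊆B i vw)
    ... | inj₂ (u , e , vu , Ae , j) = Walks.reach-step Σ B i e (reach-⊆ A⊆B i vu) (A⊆B e Ae) j

    kc-antitone : ∀ {A B} → (∀ e → A e ≡ true → B e ≡ true) → kc Σ B ≤ kc Σ A
    kc-antitone {A} {B} A⊆B = subst₂ _≤_ (sym (count-allFin n _)) (sym (count-allFin n _)) (∑⟦⟧-mono n repB⇒repA)
      where
      repB⇒repA : ∀ v → isRep Σ B v ≡ true → isRep Σ A v ≡ true
      repB⇒repA v r = Walks.minimal⇒isRep Σ A v λ u u<v → not-connected u u<v
        where
        not-connected : ∀ u → toℕ u < toℕ v → sameComp Σ A u v ≡ false
        not-connected u u<v with sameComp Σ A u v in c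
        ... | false = refl
        ... | true  = ⊥-elim (true≢false (trans (sym (reach-⊆ A⊆B n c)) (Walks.isRep⇒minimal Σ B v r u u<v)))

module NegativeCycles where

  open import Data.Bool using (Bool; true; false; _∧_; not)
  open import Data.Nat using (ℕ; zero; suc; _+_; _≤_; _<_; z≤n; s≤s)
  open import Data.Nat.Properties using (module ≤-Reasoning; n≮0; m+n≤o⇒n≤o; ≤-refl; ≤-trans; ≤-reflexive; ≤-pred; +-suc; m≤m+n; m≤n+m; +-monoʳ-<)
  open import Data.Fin using (Fin)
  open import Data.List using (List; []; _∷_; _++_; map; allFin; length; concatMap)
  open import Data.List.Properties using (map-++; ++-assoc; length-++; length-map)
  open import Data.List.Relation.Unary.Any using (here)
  open import Data.List.Membership.Propositional using (_∈_; lose)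
  open import Data.List.Membership.Propositional.Properties using (∈-allFin; ∈-upTo⁺; ∈-map⁺; ∈-map⁻; ∈-∃++; ∈-++⁺ʳ; ∈-concatMap⁺)
  open import Data.Bool.ListAction using (any)
  open import Data.Product using (_×_; _,_; proj₁; proj₂; ∃)
  open import Data.Sum using (_⊎_; inj₁; inj₂)
  open import Data.Empty using (⊥-elim)
  open import Relation.Binary.PropositionalEquality
  open import Defs
  open Enumeration
  open Connectivity

  distinct-≢ : ∀ {k} xs (a : Fin k) ys b zs → distinct (xs ++ a ∷ ys ++ b ∷ zs) ≡ true → a ≢ b
  distinct-≢ []       a ys b zs d refl with any (a ==_) (ys ++ a ∷ zs) in a∈
  ... | false = true≢false (trans (sym (any⁺ _ (∈-++⁺ʳ ys (here refl)) (==-refl a))) a∈)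
  distinct-≢ (x ∷ xs) a ys b zs d = distinct-≢ xs a ys b zs (proj₂ (∧-true⁻ d))

  ¬distinct⇒split : ∀ {A : Set} {k} (key : A → Fin k) (l : List A) → distinct (map key l) ≡ false →
                    ∃ λ p → ∃ λ x → ∃ λ q → ∃ λ y → ∃ λ r → l ≡ p ++ x ∷ q ++ y ∷ r × key x ≡ key y
  ¬distinct⇒split key (x ∷ l) d with any (key x ==_) (map key l) in dup
  ... | true with any⁻ _ (map key l) dup
  ...   | _ , k∈ , x==k with ∈-map⁻ key k∈
  ...     | y , y∈l , refl with ∈-∃++ y∈l
  ...       | q , r , refl = [] , x , q , y , r , refl , ==⇒≡ x==k
  ¬distinct⇒split key (x ∷ l) d | false with ¬distinct⇒split key l d
  ... | p , x′ , q , y , r , refl , kk = x ∷ p , x′ , q , y , r , refl , kk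

  distinct⇒length≤ : ∀ {k} (ks : List (Fin k)) → distinct ks ≡ true → length ks ≤ k
  distinct⇒length≤ {k} ks d = begin
    length ks                                      ≡⟨ length≡∑ ks ⟩
    ∑[ x ∈ ks ] 1                                  ≡⟨ ∑ₗ-cong ks (λ x → sym (trans (∑ₗ-allFin k _) (∑-==ˡ k x))) ⟩
    ∑[ x ∈ ks ] ∑[ i ∈ allFin k ] ⟦ x == i ⟧       ≡⟨ ∑ₗ-comm ks (allFin k) _ ⟩
    ∑[ i ∈ allFin k ] ∑[ x ∈ ks ] ⟦ x == i ⟧       ≤⟨ ∑ₗ-mono (allFin k) (λ i → occurs≤1 ks i d) ⟩
    ∑[ i ∈ allFin k ] 1                            ≡⟨ ∑-allFin-1 k ⟩
    k                                              ∎
    where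
    open ≤-Reasoning
    absent : ∀ {k} (x : Fin k) ys → any (x ==_) ys ≡ false → ∑[ y ∈ ys ] ⟦ y == x ⟧ ≡ 0
    absent x []       _ = refl
    absent x (y ∷ ys) h with x == y in xy
    ... | false = cong₂ _+_ (cong ⟦_⟧ (trans (==-sym y x) xy)) (absent x ys h)
    occurs≤1 : ∀ {k} (ks : List (Fin k)) i → distinct ks ≡ true → ∑[ x ∈ ks ] ⟦ x == i ⟧ ≤ 1
    occurs≤1 []       i d = z≤n
    occurs≤1 (x ∷ ks) i d with any (x ==_) ks in x∉ks | x == i in xi
    ... | false | true with ==⇒≡ xi
    ...   | refl = ≤-reflexive (cong suc (absent x ks x∉ks))
    occurs≤1 (x ∷ ks) i d | false | false = occurs≤1 ks i d

  ∈-seqs : ∀ {B : Set} (xs : List B) → (∀ a → a ∈ xs) → ∀ c → c ∈ seqs xs (length c)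
  ∈-seqs xs all∈ []      = here refl
  ∈-seqs xs all∈ (a ∷ c) = ∈-concatMap⁺ _ (lose (all∈ a) (∈-map⁺ (a ∷_) (∈-seqs xs all∈ c)))

  ∈-candidates : ∀ {n} (Σ : SignedGraph n) c → 1 ≤ length c → length c ≤ n → c ∈ candidates Σ
  ∈-candidates {n} Σ c 1≤len len≤n with length c in len≡
  ... | suc ℓ = ∈-concatMap⁺ _ (lose (∈-map⁺ suc (∈-upTo⁺ len≤n))
                  (subst (λ z → c ∈ seqs steps z) len≡ (∈-seqs steps every-step c)))
    where
    steps = concatMap (λ v → map (v ,_) (allFin (nE Σ))) (allFin n)
    every-step : ∀ s → s ∈ steps
    every-step (v , e) = ∈-concatMap⁺ _ (lose (∈-allFin v) (∈-map⁺ (v ,_) (∈-allFin e)))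

  module Cycles {n : ℕ} (Σ : SignedGraph n) (A : EdgeSet Σ) where
    open Walks Σ A

    private
      pieces-linked : ∀ v₀ (p : Steps) x (q : Steps) y (r : Steps) → linked Σ v₀ (p ++ x ∷ q ++ y ∷ r) ≡ true →
        linked Σ (proj₁ x) p ≡ true × linked Σ (proj₁ y) (x ∷ q) ≡ true × linked Σ v₀ (y ∷ r) ≡ true
      pieces-linked v₀ p x q y r c =
        let c₁ , c₂₃ = ∧-true⁻ (trans (sym (linked-++ v₀ p (x ∷ q ++ y ∷ r))) c)
            c₂ , c₃ = ∧-true⁻ (trans (sym (linked-++ v₀ (x ∷ q) (y ∷ r))) c₂₃)
        in c₁ , c₂ , c₃

      pieces-inA : ∀ (p : Steps) x (q : Steps) y (r : Steps) → inA (p ++ x ∷ q ++ y ∷ r) ≡ true →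
        inA p ≡ true × inA (x ∷ q) ≡ true × inA (y ∷ r) ≡ true
      pieces-inA p x q y r i =
        let i₁ , i₂₃ = ∧-true⁻ (trans (sym (inA-++ p (x ∷ q ++ y ∷ r))) i)
            i₂ , i₃ = ∧-true⁻ (trans (sym (inA-++ (x ∷ q) (y ∷ r))) i₂₃)
        in i₁ , i₂ , i₃

      vertices-pieces : ∀ (p : Steps) vx e (q : Steps) vy (r : Steps) →
        map proj₁ (p ++ (vx , e) ∷ q ++ (vy , e) ∷ r) ≡ map proj₁ p ++ vx ∷ map proj₁ q ++ vy ∷ map proj₁ r
      vertices-pieces p vx e q vy r =
        trans (map-++ proj₁ p _) (cong (λ z → map proj₁ p ++ vx ∷ z) (map-++ proj₁ q ((vy , e) ∷ r)))

      joins-both : ∀ e a b c d → joins Σ e a b ≡ true → joins Σ e c d ≡ true →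
                   (a ≡ c × b ≡ d) ⊎ (a ≡ d × b ≡ c)
      joins-both e a b c d j j′ with joins⇒ends e a b j | joins⇒ends e c d j′
      ... | inj₁ (p , q) | inj₁ (p′ , q′) = inj₁ (trans (sym p) p′ , trans (sym q) q′)
      ... | inj₁ (p , q) | inj₂ (p′ , q′) = inj₂ (trans (sym p) p′ , trans (sym q) q′)
      ... | inj₂ (p , q) | inj₁ (p′ , q′) = inj₂ (trans (sym q) q′ , trans (sym p) p′)
      ... | inj₂ (p , q) | inj₂ (p′ , q′) = inj₁ (trans (sym q) q′ , trans (sym p) p′)

      back-and-forth : ∀ v₀ (p : Steps) vx e (q : Steps) vy (r : Steps) → let l = p ++ (vx , e) ∷ q ++ (vy , e) ∷ r in
        start v₀ l ≡ v₀ → distinct (map proj₁ l) ≡ true →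
        vx ≡ start v₀ r → start vy q ≡ vy → signProduct Σ l ≡ true
      back-and-forth v₀ p vx e ((u , f) ∷ q) vy r _ d _ u≡vy =
        ⊥-elim (distinct-≢ (map proj₁ p ++ vx ∷ []) u (map proj₁ q) vy (map proj₁ r) d′ u≡vy)
        where
        d′ = subst (λ (z : List (Fin n)) → distinct z ≡ true)
               (trans (vertices-pieces p vx e ((u , f) ∷ q) vy r) (sym (++-assoc (map proj₁ p) (vx ∷ []) _))) d
      back-and-forth v₀ p vx e [] vy ((u , f) ∷ r) _ d vx≡u _ =
        ⊥-elim (distinct-≢ (map proj₁ p) vx (vy ∷ []) u (map proj₁ r) d′ vx≡u)
        where d′ = subst (λ (z : List (Fin n)) → distinct z ≡ true) (vertices-pieces p vx e [] vy ((u , f) ∷ r)) d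
      back-and-forth v₀ ((u , f) ∷ p) vx e [] vy [] u≡v₀ d vx≡v₀ _ =
        ⊥-elim (distinct-≢ [] u (map proj₁ p) vx (vy ∷ []) d′ (trans u≡v₀ (sym vx≡v₀)))
        where d′ = subst (λ (z : List (Fin n)) → distinct z ≡ true) (cong (u ∷_) (vertices-pieces p vx e [] vy [])) d
      back-and-forth v₀ [] vx e [] vy [] _ _ _ _ = ·-cancelˡ (sign Σ e) true

    -- In a closed walk without repeated vertices an edge can only repeat as the walk v e u e,
    -- whose sign is positive.
    repeatedEdge-positive : ∀ v₀ (p : Steps) vx e (q : Steps) vy (r : Steps) → let l = p ++ (vx , e) ∷ q ++ (vy , e) ∷ r in
      start v₀ l ≡ v₀ → linked Σ v₀ l ≡ true → distinct (map proj₁ l) ≡ true → signProduct Σ l ≡ true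
    repeatedEdge-positive v₀ p vx e q vy r closed c d
      with joins-both e vx (start vy q) vy (start v₀ r)
             (proj₁ (∧-true⁻ (trans (sym (linked-∷ vy vx e q)) (proj₁ (proj₂ pieces)))))
             (proj₁ (∧-true⁻ (trans (sym (linked-∷ v₀ vy e r)) (proj₂ (proj₂ pieces)))))
      where pieces = pieces-linked v₀ p (vx , e) q (vy , e) r c
    ... | inj₁ (vx≡vy , _) = ⊥-elim (distinct-≢ (map proj₁ p) vx (map proj₁ q) vy (map proj₁ r) d′ vx≡vy)
      where d′ = subst (λ (z : List (Fin n)) → distinct z ≡ true) (vertices-pieces p vx e q vy r) d
    ... | inj₂ (vx≡next , prev≡vy) = back-and-forth v₀ p vx e q vy r closed d vx≡next prev≡vy

    record NegativeCycle (root : Fin n) : Set where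
      constructor negativeCycle
      field
        first    : Fin n × Edge Σ
        rest     : Steps
        isCyc    : isCycle Σ A (first ∷ rest) ≡ true
        negative : signProduct Σ (first ∷ rest) ≡ false
        reached  : Connected root (proj₁ first) ≡ true

    private
      found : ∀ {root} v₀ l → start v₀ l ≡ v₀ → linked Σ v₀ l ≡ true → inA l ≡ true →
              distinct (map proj₁ l) ≡ true → distinct (map proj₂ l) ≡ true →
              signProduct Σ l ≡ false → Connected root v₀ ≡ true → NegativeCycle root
      found v₀ ((v , e) ∷ c) refl ch ins dv de neg conn =
        negativeCycle (v , e) c (∧-true⁺ ins (∧-true⁺ dv (∧-true⁺ de ch))) neg conn

      length-pieces : ∀ (p : Steps) x (q : Steps) y (r : Steps) →
                      length (p ++ x ∷ q ++ y ∷ r) ≡ length p + suc (length q + suc (length r))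
      length-pieces p x q y r = trans (length-++ p) (cong (λ z → length p + suc z) (length-++ q))

      shorter₁ : ∀ a b c → suc (suc b) ≤ a + suc (b + suc c)
      shorter₁ a b c = ≤-trans (s≤s (s≤s (m≤m+n b c))) (≤-trans (≤-reflexive (cong suc (sym (+-suc b c)))) (m≤n+m _ a))

      shorter₂ : ∀ a b c → suc (a + suc c) ≤ a + suc (b + suc c)
      shorter₂ a b c = +-monoʳ-< a (s≤s (m≤n+m (suc c) b))

    extract : ∀ {root} k v₀ l → length l ≤ k → start v₀ l ≡ v₀ → linked Σ v₀ l ≡ true → inA l ≡ true →
              signProduct Σ l ≡ false → Connected root v₀ ≡ true → NegativeCycle root

    -- A closed walk repeating the vertex vx splits into the loop at vx and the rest; one of
    -- the two is negative, since signs multiply.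
    extract-repeat : ∀ {root} k v₀ p vx ex q ey r → let l = p ++ (vx , ex) ∷ q ++ (vx , ey) ∷ r in
      length l ≤ k → start v₀ l ≡ v₀ → linked Σ v₀ l ≡ true → inA l ≡ true →
      signProduct Σ l ≡ false → Connected root v₀ ≡ true → NegativeCycle root

    extract k v₀ l len closed ch ins neg conn with distinct (map proj₁ l) in dv
    ... | false with ¬distinct⇒split proj₁ l dv
    ...   | p , (vx , ex) , q , (.vx , ey) , r , refl , refl =
      extract-repeat k v₀ p vx ex q ey r len closed ch ins neg conn
    extract k v₀ l len closed ch ins neg conn | true with distinct (map proj₂ l) in de
    ... | true  = found v₀ l closed ch ins dv de neg conn
    ... | false with ¬distinct⇒split proj₂ l de
    ...   | p , (vx , e) , q , (vy , .e) , r , refl , refl =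
      ⊥-elim (true≢false (trans (sym (repeatedEdge-positive v₀ p vx e q vy r closed ch dv)) neg))

    extract-repeat zero v₀ p vx ex q ey r len _ _ _ _ _ =
      ⊥-elim (n≮0 (m+n≤o⇒n≤o (length p) (subst (_≤ 0) (length-pieces p (vx , ex) q (vx , ey) r) len)))
    extract-repeat {root} (suc k) v₀ p vx ex q ey r len closed ch ins neg conn = choose _ refl
      where
      loop = (vx , ex) ∷ q
      rest = p ++ (vx , ey) ∷ r
      pieces = pieces-linked v₀ p (vx , ex) q (vx , ey) r ch
      insides = pieces-inA p (vx , ex) q (vx , ey) r ins
      len′ : length p + suc (length q + suc (length r)) ≤ suc k
      len′ = subst (_≤ suc k) (length-pieces p (vx , ex) q (vx , ey) r) len
      p-start : start vx p ≡ v₀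
      p-start = trans (sym (start-++ v₀ p _)) closed
      sign-split : signProduct Σ (p ++ loop ++ (vx , ey) ∷ r)
                 ≡ signProduct Σ p · (signProduct Σ loop · signProduct Σ ((vx , ey) ∷ r))
      sign-split = trans (signProduct-++ p _) (cong (signProduct Σ p ·_) (signProduct-++ loop _))
      choose : ∀ s → signProduct Σ loop ≡ s → NegativeCycle root
      choose false loop-sign =
        extract k vx loop (≤-pred (≤-trans (shorter₁ (length p) (length q) (length r)) len′)) refl
          (proj₁ (proj₂ pieces)) (proj₁ (proj₂ insides)) loop-sign
          (connected-trans conn (walk⇒connected (walk p p-start (proj₁ pieces) (proj₁ insides))))
      choose true loop-sign =
        extract k v₀ rest
          (≤-pred (≤-trans (subst (λ z → suc z ≤ _) (sym (length-++ p)) (shorter₂ (length p) (length q) (length r))) len′))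
          (trans (start-++ v₀ p _) p-start)
          (trans (linked-++ v₀ p _) (∧-true⁺ (proj₁ pieces) (proj₂ (proj₂ pieces))))
          (trans (inA-++ p _) (∧-true⁺ (proj₁ insides) (proj₂ (proj₂ insides))))
          (trans (signProduct-++ p _)
            (trans (cong (λ z → signProduct Σ p · (z · signProduct Σ ((vx , ey) ∷ r))) (sym loop-sign))
              (trans (sym sign-split) neg)))
          conn

    negativeCycle⇒compUnbalanced : ∀ {root} → NegativeCycle root → compUnbalanced Σ A root ≡ true
    negativeCycle⇒compUnbalanced (negativeCycle first rest isCyc neg reached) =
      any⁺ _ (∈-candidates Σ (first ∷ rest) (s≤s z≤n) bounded) (∧-true⁺ isCyc (∧-true⁺ (cong not neg) reached))
      where
      vertices = map proj₁ (first ∷ rest)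
      distinctVertices : distinct vertices ≡ true
      distinctVertices = proj₁ (∧-true⁻ {distinct vertices} (proj₂ (∧-true⁻ {inA (first ∷ rest)} isCyc)))
      bounded : length (first ∷ rest) ≤ n
      bounded = subst (_≤ n) (length-map proj₁ (first ∷ rest)) (distinct⇒length≤ vertices distinctVertices)

    negativeClosedWalk⇒compUnbalanced : ∀ {root v} (W : Walk v v) → walkSign W ≡ false →
                                        Connected root v ≡ true → compUnbalanced Σ A root ≡ true
    negativeClosedWalk⇒compUnbalanced {v = v} (walk l closed ch ins) neg conn =
      negativeCycle⇒compUnbalanced (extract (length l) v l ≤-refl closed ch ins neg conn)

module ImproperColourings where

  open import Data.Bool using (Bool; true; false; _∧_; _∨_; not; if_then_else_)
  open import Data.Nat using (ℕ; _+_; _*_)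
  open import Data.Nat.Properties using (*-identityʳ; +-identityʳ)
  open import Data.Fin using (Fin)
  open import Function using (_∘_)
  open import Data.List using (List; []; _∷_; map; allFin)
  open import Data.List.Membership.Propositional.Properties using (∈-allFin)
  open import Data.Bool.ListAction using (any; all)
  open import Data.Product using (_,_; proj₁; proj₂)
  open import Data.Sum using (inj₁; inj₂)
  open import Data.Empty using (⊥-elim)
  open import Data.Bool.Properties using (if-float; not-injective)
  open import Relation.Binary.PropositionalEquality
  open import Defs hiding (_^_)
  open Enumeration
  open Connectivity
  open NegativeCycles

  module Colourings {n m : ℕ} (Σ : SignedGraph n) (ι : Fin m → Fin m) (ι-involutive : ∀ s → ι (ι s) ≡ s) where

    twist : Sign → Fin m → Fin m
    twist s x = if s then x else ι x

    twist-involutive : ∀ s x → twist s (twist s x) ≡ x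
    twist-involutive true  x = refl
    twist-involutive false x = ι-involutive x

    twist-twist : ∀ a b x → twist a (twist b x) ≡ twist (b · a) x
    twist-twist true  true  x = refl
    twist-twist true  false x = refl
    twist-twist false true  x = refl
    twist-twist false false x = ι-involutive x

    ι-twist : ∀ s x → ι (twist s x) ≡ twist s (ι x)
    ι-twist true  x = refl
    ι-twist false x = refl

    twist-fixed : ∀ s x → ι x ≡ x → twist s x ≡ x
    twist-fixed true  x _   = refl
    twist-fixed false x ιx≡x = ιx≡x

    Colouring : Set
    Colouring = Fin n → Fin m

    conflict : Colouring → Edge Σ → Bool
    conflict f e = if sign Σ e then f (ends₁ Σ e) == f (ends₂ Σ e) else ι (f (ends₁ Σ e)) == f (ends₂ Σ e)

    conflict≡ : ∀ f e → conflict f e ≡ (twist (sign Σ e) (f (ends₁ Σ e)) == f (ends₂ Σ e))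
    conflict≡ f e with sign Σ e
    ... | true  = refl
    ... | false = refl

    conflict⇒ : ∀ f e → conflict f e ≡ true → f (ends₂ Σ e) ≡ twist (sign Σ e) (f (ends₁ Σ e))
    conflict⇒ f e c = sym (==⇒≡ (trans (sym (conflict≡ f e)) c))

    conflict⇐ : ∀ f e → f (ends₂ Σ e) ≡ twist (sign Σ e) (f (ends₁ Σ e)) → conflict f e ≡ true
    conflict⇐ f e eq = trans (conflict≡ f e) (subst (λ z → (twist (sign Σ e) (f (ends₁ Σ e)) == z) ≡ true) (sym eq) (==-refl _))

    conflict-cong : ∀ {f f′} → (∀ v → f v ≡ f′ v) → ∀ e → conflict f e ≡ conflict f′ e
    conflict-cong f≗f′ e rewrite f≗f′ (ends₁ Σ e) | f≗f′ (ends₂ Σ e) = refl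

    proper≡ : ∀ f → proper Σ ι f ≡ all (λ e → not (conflict f e)) (allFin (nE Σ))
    proper≡ f = all-cong (λ e → sym (if-float not (sign Σ e))) (allFin (nE Σ))

    improperOn : EdgeSet Σ → Colouring → Bool
    improperOn A f = all (λ e → not (A e) ∨ conflict f e) (allFin (nE Σ))

    improperOn-cong : ∀ A {f f′} → (∀ v → f v ≡ f′ v) → improperOn A f ≡ improperOn A f′
    improperOn-cong A f≗f′ = all-cong (λ e → cong (not (A e) ∨_) (conflict-cong f≗f′ e)) (allFin (nE Σ))

    improperOn-mono : ∀ {A B} → (∀ e → B e ≡ true → A e ≡ true) → ∀ {f} → improperOn A f ≡ true → improperOn B f ≡ true
    improperOn-mono {A} {B} B⊆A {f} h = all⁺ _ (allFin (nE Σ)) λ {e} _ → at e (B e) refl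
      where
      at : ∀ e b → B e ≡ b → (not b ∨ conflict f e) ≡ true
      at e false _  = refl
      at e true  Be = subst (λ a → (not a ∨ conflict f e) ≡ true) (B⊆A e Be) (all⁻ _ h (∈-allFin e))

    conflictOn : ∀ A {f e} → improperOn A f ≡ true → A e ≡ true → conflict f e ≡ true
    conflictOn A {f} {e} h Ae = subst (λ a → (not a ∨ conflict f e) ≡ true) Ae (all⁻ _ h (∈-allFin e))

    improperOn-pointwise : ∀ (_∙_ : Fin m → Fin m → Fin m) → (∀ s x y → twist s (x ∙ y) ≡ twist s x ∙ twist s y) →
                           ∀ A {f g} → improperOn A f ≡ true → improperOn A g ≡ true →
                           improperOn A (λ v → f v ∙ g v) ≡ true
    improperOn-pointwise _∙_ twist-∙ A {f} {g} hf hg = all⁺ _ (allFin (nE Σ)) λ {e} _ → at e (A e) refl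
      where
      at : ∀ e a → A e ≡ a → (not a ∨ conflict (λ v → f v ∙ g v) e) ≡ true
      at e false _  = refl
      at e true  Ae = conflict⇐ (λ v → f v ∙ g v) e
        (trans (cong₂ _∙_ (conflict⇒ f e (conflictOn A {f} hf Ae)) (conflict⇒ g e (conflictOn A {g} hg Ae)))
               (sym (twist-∙ (sign Σ e) _ _)))

    module _ (A : EdgeSet Σ) where
      open Walks Σ A
      open Cycles Σ A

      edge-twist : ∀ {f} → improperOn A f ≡ true → ∀ {e u w} → A e ≡ true → joins Σ e u w ≡ true →
                   f w ≡ twist (sign Σ e) (f u)
      edge-twist {f} h {e} {u} {w} Ae j with joins⇒ends e u w j | conflict⇒ f e (conflictOn A {f} h Ae)
      ... | inj₁ (refl , refl) | fw≡ = fw≡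
      ... | inj₂ (refl , refl) | fu≡ = trans (sym (twist-involutive (sign Σ e) (f w))) (cong (twist (sign Σ e)) (sym fu≡))

      walk-twist : ∀ {f} → improperOn A f ≡ true → ∀ {v w} (W : Walk v w) → f w ≡ twist (walkSign W) (f v)
      walk-twist {f} h {w = w} (walk xs refl c i) = along xs c i
        where
        along : ∀ xs → linked Σ w xs ≡ true → inA xs ≡ true → f w ≡ twist (signProduct Σ xs) (f (start w xs))
        along []             _ _ = refl
        along ((v , e) ∷ xs) c i =
          let j , c′ = ∧-true⁻ (trans (sym (linked-∷ w v e xs)) c) ; Ae , i′ = ∧-true⁻ i in
          trans (along xs c′ i′) (trans (cong (twist (signProduct Σ xs)) (edge-twist {f} h Ae j)) (twist-twist _ (sign Σ e) (f v)))

      walk-twist⁻¹ : ∀ {f} → improperOn A f ≡ true → ∀ {v w} (W : Walk v w) → f v ≡ twist (walkSign W) (f w)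
      walk-twist⁻¹ {f} h {v} W = trans (sym (twist-involutive (walkSign W) (f v))) (cong (twist (walkSign W)) (sym (walk-twist h W)))

      unbalanced⇒fixed : ∀ {f} → improperOn A f ≡ true → ∀ v → compUnbalanced Σ A v ≡ true → ι (f v) ≡ f v
      unbalanced⇒fixed {f} h v u with any⁻ _ (candidates Σ) u
      ... | (w , e) ∷ rest , _ , ok =
        let isCyc , ok′ = ∧-true⁻ ok ; negative , vw = ∧-true⁻ ok′
            vertices = distinct (map proj₁ ((w , e) ∷ rest))
            edges = distinct (map proj₂ ((w , e) ∷ rest))
            ins , cyc′ = ∧-true⁻ {inA ((w , e) ∷ rest)} isCyc
            closed = proj₂ (∧-true⁻ {edges} (proj₂ (∧-true⁻ {vertices} cyc′)))
            C = walk ((w , e) ∷ rest) refl closed ins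
            W = connected⇒walk vw
            fw-fixed : f w ≡ ι (f w)
            fw-fixed = trans (walk-twist h C) (cong (λ s → twist s (f w)) (not-injective negative))
        in begin
          ι (f v)                       ≡⟨ cong ι (walk-twist⁻¹ h W) ⟩
          ι (twist (walkSign W) (f w))      ≡⟨ ι-twist (walkSign W) (f w) ⟩
          twist (walkSign W) (ι (f w))      ≡⟨ cong (twist (walkSign W)) (sym fw-fixed) ⟩
          twist (walkSign W) (f w)          ≡⟨ sym (walk-twist⁻¹ h W) ⟩
          f v                           ∎
        where open ≡-Reasoning

      balanced⇒closedWalk-positive : ∀ {u} → compUnbalanced Σ A u ≡ false → (W : Walk u u) → walkSign W ≡ true
      balanced⇒closedWalk-positive {u} bal W with walkSign W in s
      ... | true  = refl
      ... | false = ⊥-elim (true≢false (trans (sym (negativeClosedWalk⇒compUnbalanced W s (connected-refl u))) bal))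

      private
        ·-true⇒≡ : ∀ a b → a · b ≡ true → a ≡ b
        ·-true⇒≡ true  b     ab = sym ab
        ·-true⇒≡ false false _  = refl

      balanced⇒walkSign-unique : ∀ {u u′ w} → compUnbalanced Σ A u ≡ false → u′ ≡ u →
                                 (W₁ : Walk u w) (W₂ : Walk u′ w) → walkSign W₂ ≡ walkSign W₁
      balanced⇒walkSign-unique bal refl W₁ W₂ = sym (·-true⇒≡ _ _ (begin
        walkSign W₁ · walkSign W₂              ≡⟨ cong (walkSign W₁ ·_) (sym (walkSign-reverse W₂)) ⟩
        walkSign W₁ · walkSign (reverseʷ W₂)   ≡⟨ sym (walkSign-++ W₁ (reverseʷ W₂)) ⟩
        walkSign (W₁ ++ʷ reverseʷ W₂)          ≡⟨ balanced⇒closedWalk-positive bal (W₁ ++ʷ reverseʷ W₂) ⟩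
        true                                   ∎))
        where open ≡-Reasoning

    module Canonical (A : EdgeSet Σ) (c₀ : Fin m) where
      open Walks Σ A

      allowed : Fin n → Fin m → Bool
      allowed v b = if isRep Σ A v then (if compUnbalanced Σ A v then ι b == b else true) else b == c₀

      canonical : Colouring → Bool
      canonical g = all (λ v → allowed v (g v)) (allFin n)

      restrict : Colouring → Colouring
      restrict f v = if isRep Σ A v then f v else c₀

      path : ∀ w → Walk (rep w) w
      path w = connected⇒walk (rep-connected w)

      extend : Colouring → Colouring
      extend g w = twist (walkSign (path w)) (g (rep w))

      canonical⇒allowed : ∀ {g} → canonical g ≡ true → ∀ v → allowed v (g v) ≡ true
      canonical⇒allowed c v = all⁻ _ c (∈-allFin v)

      restrict-canonical : ∀ f → improperOn A f ≡ true → canonical (restrict f) ≡ true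
      restrict-canonical f h = all⁺ _ (allFin n) λ {v} _ → at v
        where
        at : ∀ v → allowed v (restrict f v) ≡ true
        at v with isRep Σ A v | compUnbalanced Σ A v in unb
        ... | true  | true  = subst (λ z → (z == f v) ≡ true) (sym (unbalanced⇒fixed A h v unb)) (==-refl (f v))
        ... | true  | false = refl
        ... | false | _     = ==-refl c₀

      extend-improper : ∀ g → canonical g ≡ true → improperOn A (extend g) ≡ true
      extend-improper g c = all⁺ _ (allFin (nE Σ)) λ {e} _ → at e (A e) refl
        where
        at : ∀ e a → A e ≡ a → (not a ∨ conflict (extend g) e) ≡ true
        at e false _  = refl
        at e true  Ae = conflict⇐ (extend g) e (begin
          twist (walkSign (path b)) (g (rep b))               ≡⟨ cong (λ x → twist (walkSign (path b)) (g x)) rb≡ra ⟩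
          twist (walkSign (path b)) (g r)                     ≡⟨ twists-agree (compUnbalanced Σ A r) refl ⟩
          twist (walkSign (path a) · sign Σ e) (g r)          ≡⟨ sym (twist-twist (sign Σ e) (walkSign (path a)) (g r)) ⟩
          twist (sign Σ e) (twist (walkSign (path a)) (g r))  ∎)
          where
          open ≡-Reasoning
          a = ends₁ Σ e
          b = ends₂ Σ e
          r = rep a
          ab : joins Σ e a b ≡ true
          ab = ∨-true⁺ˡ _ (∧-true⁺ (==-refl a) (==-refl b))
          rb≡ra : rep b ≡ r
          rb≡ra = sym (rep-cong (walk⇒connected (edgeʷ e Ae ab)))
          twists-agree : ∀ u → compUnbalanced Σ A r ≡ u →
                         twist (walkSign (path b)) (g r) ≡ twist (walkSign (path a) · sign Σ e) (g r)
          twists-agree true unb = trans (twist-fixed _ _ fixed) (sym (twist-fixed _ _ fixed))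
            where
            fixed : ι (g r) ≡ g r
            fixed = ==⇒≡ (subst₂ (λ x y → (if x then (if y then ι (g r) == g r else true) else g r == c₀) ≡ true)
                                  (rep-isRep a) unb (canonical⇒allowed c r))
          twists-agree false bal = cong (λ s → twist s (g r)) (begin
            walkSign (path b)                             ≡⟨ balanced⇒walkSign-unique A bal rb≡ra (path a ++ʷ edgeʷ e Ae ab) (path b) ⟩
            walkSign (path a ++ʷ edgeʷ e Ae ab)           ≡⟨ walkSign-++ (path a) (edgeʷ e Ae ab) ⟩
            walkSign (path a) · walkSign (edgeʷ e Ae ab)  ≡⟨ cong (walkSign (path a) ·_) (walkSign-edge e Ae ab) ⟩
            walkSign (path a) · sign Σ e                  ∎)

      extend∘restrict : ∀ f → improperOn A f ≡ true → ∀ w → extend (restrict f) w ≡ f w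
      extend∘restrict f h w = begin
        twist (walkSign (path w)) (restrict f (rep w))  ≡⟨ cong (λ x → twist (walkSign (path w)) (if x then f (rep w) else c₀)) (rep-isRep w) ⟩
        twist (walkSign (path w)) (f (rep w))           ≡⟨ sym (walk-twist A h (path w)) ⟩
        f w                                         ∎
        where open ≡-Reasoning

      restrict∘extend : ∀ g → canonical g ≡ true → ∀ v → restrict (extend g) v ≡ g v
      restrict∘extend g c v with isRep Σ A v in isrep | canonical⇒allowed c v
      ... | false | g≡c₀ = sym (==⇒≡ g≡c₀)
      ... | true  | ok   = cases (compUnbalanced Σ A v) refl
        where
        rv≡v : rep v ≡ v
        rv≡v = isRep⇒rep≡ v isrep
        s = walkSign (path v)
        cases : ∀ u → compUnbalanced Σ A v ≡ u → twist s (g (rep v)) ≡ g v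
        cases true unb = trans (cong (twist s ∘ g) rv≡v) (twist-fixed s (g v) (==⇒≡ fixed))
          where fixed = subst (λ y → (if y then ι (g v) == g v else true) ≡ true) unb ok
        cases false bal = trans (cong (twist s ∘ g) rv≡v)
                                (cong (λ x → twist x (g v)) (balanced⇒walkSign-unique A bal rv≡v ([]ʷ v) (path v)))

      open FunctionCounting n m

      improper≃canonical : CountingBijection (improperOn A) canonical
      improper≃canonical = record
        { to        = restrict
        ; from      = extend
        ; P-resp    = improperOn-cong A
        ; Q-resp    = λ g≗g′ → all-cong (λ v → cong (allowed v) (g≗g′ v)) (allFin n)
        ; to-resp   = λ f≗f′ v → cong (λ x → if isRep Σ A v then x else c₀) (f≗f′ v)
        ; from-resp = λ g≗g′ w → cong (twist (walkSign (path w))) (g≗g′ (rep w))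
        ; to-Q      = restrict-canonical
        ; from-P    = extend-improper
        ; from∘to   = extend∘restrict
        ; to∘from   = restrict∘extend
        }

      allowed-count : ∀ v → ∑[ b ∈ allFin m ] ⟦ allowed v b ⟧
                          ≡ m ^ ⟦ isRep Σ A v ∧ not (compUnbalanced Σ A v) ⟧ * fixedPoints ι ^ ⟦ isRep Σ A v ∧ compUnbalanced Σ A v ⟧
      allowed-count v with isRep Σ A v | compUnbalanced Σ A v
      ... | true  | true  = trans (sym (count≡∑ (λ s → ι s == s) (allFin m))) (sym (trans (+-identityʳ _) (*-identityʳ _)))
      ... | true  | false = trans (∑-allFin-1 m) (sym (trans (*-identityʳ _) (*-identityʳ m)))
      ... | false | _     = trans (∑ₗ-cong (allFin m) (λ b → cong ⟦_⟧ (==-sym b c₀))) (trans (∑ₗ-allFin m _) (∑-==ˡ m c₀))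

      count-canonical : count canonical funs ≡ m ^ kb Σ A * fixedPoints ι ^ ku Σ A
      count-canonical = begin
        count canonical funs
          ≡⟨ count≡∑ canonical funs ⟩
        ∑[ g ∈ funs ] ⟦ canonical g ⟧
          ≡⟨ ∑ₗ-cong funs (λ g → ⟦all-allFin⟧ n _) ⟩
        ∑[ g ∈ funs ] ∏ (λ v → ⟦ allowed v (g v) ⟧)
          ≡⟨ ∑-allFuns-∏ n (allFin m) (λ v b → ⟦ allowed v b ⟧) ⟩
        ∏ (λ v → ∑[ b ∈ allFin m ] ⟦ allowed v b ⟧)
          ≡⟨ ∏-cong allowed-count ⟩
        ∏ (λ v → m ^ balancedRep v * t ^ unbalancedRep v)
          ≡⟨ ∏-distrib-* (λ v → m ^ balancedRep v) (λ v → t ^ unbalancedRep v) ⟩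
        ∏ (λ v → m ^ balancedRep v) * ∏ (λ v → t ^ unbalancedRep v)
          ≡⟨ sym (cong₂ _*_ (^-∑ m balancedRep) (^-∑ t unbalancedRep)) ⟩
        m ^ sum balancedRep * t ^ sum unbalancedRep
          ≡⟨ sym (cong₂ (λ a b → m ^ a * t ^ b) (count-allFin n _) (count-allFin n _)) ⟩
        m ^ kb Σ A * t ^ ku Σ A
          ∎
        where
        open ≡-Reasoning
        t = fixedPoints ι
        balancedRep unbalancedRep : Fin n → ℕ
        balancedRep v = ⟦ isRep Σ A v ∧ not (compUnbalanced Σ A v) ⟧
        unbalancedRep v = ⟦ isRep Σ A v ∧ compUnbalanced Σ A v ⟧

      improper-count : count (improperOn A) funs ≡ m ^ kb Σ A * fixedPoints ι ^ ku Σ A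
      improper-count = trans (count-bijection improper≃canonical) count-canonical

module RankViaℤ₃ where

  open import Data.Bool using (Bool; true; false; _∧_; _∨_; not)
  open import Data.Bool.Properties using (∧-zeroʳ; ∧-identityʳ) renaming (_≟_ to _≟ᵇ_)
  open import Data.Nat using (ℕ; zero; suc; _+_; _*_; _∸_; _≤_; _<_; z≤n; s≤s)
  open import Data.Nat.DivMod using (_mod_)
  open import Data.Nat.Properties using (module ≤-Reasoning; ≤-trans; ≤-reflexive; *-monoʳ-≤; *-monoʳ-<; *-cancelˡ-≤; *-assoc; *-comm; +-comm; <⇒≱; suc-injective; +-identityʳ; *-identityʳ)
  open import Data.Fin using (Fin; zero; suc; toℕ)
  open import Data.Fin.Properties using (_≟_; all?)
  open import Relation.Nullary using (yes; no)
  open import Data.List using (allFin)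
  open import Data.Product using (_,_; proj₁; proj₂)
  open import Data.Empty using (⊥-elim)
  open import Function using (_∘_)
  open import Relation.Nullary.Decidable using (from-yes)
  open import Relation.Binary.PropositionalEquality
  open import Defs hiding (_^_)
  open Enumeration
  open Connectivity
  open ImproperColourings

  ℤ₃ : Set
  ℤ₃ = Fin 3

  infixl 6 _⊕_ _⊖_

  _⊕_ : ℤ₃ → ℤ₃ → ℤ₃
  x ⊕ y = (toℕ x + toℕ y) mod 3

  ⊖_ : ℤ₃ → ℤ₃
  ⊖ x = (3 ∸ toℕ x) mod 3

  _⊖_ : ℤ₃ → ℤ₃ → ℤ₃
  x ⊖ y = x ⊕ ⊖ y

  ⊖-involutive : ∀ x → ⊖ ⊖ x ≡ x
  ⊖-involutive = from-yes (all? λ x → ⊖ ⊖ x ≟ x)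

  ⊖-distrib-⊕ : ∀ x y → ⊖ (x ⊕ y) ≡ ⊖ x ⊕ ⊖ y
  ⊖-distrib-⊕ = from-yes (all? λ x → all? λ y → ⊖ (x ⊕ y) ≟ ⊖ x ⊕ ⊖ y)

  ⊖-distrib-⊖ : ∀ x y → ⊖ (x ⊖ y) ≡ ⊖ x ⊖ ⊖ y
  ⊖-distrib-⊖ = from-yes (all? λ x → all? λ y → ⊖ (x ⊖ y) ≟ ⊖ x ⊖ ⊖ y)

  ⊕-⊖-interchange : ∀ a b x y → (a ⊕ b) ⊖ (x ⊕ y) ≡ (a ⊖ x) ⊕ (b ⊖ y)
  ⊕-⊖-interchange = from-yes (all? λ a → all? λ b → all? λ x → all? λ y → (a ⊕ b) ⊖ (x ⊕ y) ≟ (a ⊖ x) ⊕ (b ⊖ y))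

  ⊖-⊖-interchange : ∀ a b x y → (a ⊖ b) ⊖ (x ⊖ y) ≡ (a ⊖ x) ⊖ (b ⊖ y)
  ⊖-⊖-interchange = from-yes (all? λ a → all? λ b → all? λ x → all? λ y → (a ⊖ b) ⊖ (x ⊖ y) ≟ (a ⊖ x) ⊖ (b ⊖ y))

  ⊖-⊕-cancel : ∀ x y → x ⊖ y ⊕ y ≡ x
  ⊖-⊕-cancel = from-yes (all? λ x → all? λ y → x ⊖ y ⊕ y ≟ x)

  ⊕-⊖-cancel : ∀ x y → x ⊕ y ⊖ y ≡ x
  ⊕-⊖-cancel = from-yes (all? λ x → all? λ y → x ⊕ y ⊖ y ≟ x)

  ⊖-self : ∀ x → x ⊖ x ≡ zero
  ⊖-self = from-yes (all? λ x → x ⊖ x ≟ zero)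

  ⊕-identityˡ : ∀ x → zero ⊕ x ≡ x
  ⊕-identityˡ = from-yes (all? λ x → zero ⊕ x ≟ x)

  ⊖==zero : ∀ x y → ((x ⊖ y) == zero) ≡ (x == y)
  ⊖==zero = from-yes (all? λ x → all? λ y → ((x ⊖ y) == zero) ≟ᵇ (x == y))

  module RankBound {n : ℕ} (Σ : SignedGraph n) where
    open Colourings Σ ⊖_ ⊖-involutive
    open FunctionCounting n 3

    twist-⊕ : ∀ s x y → twist s (x ⊕ y) ≡ twist s x ⊕ twist s y
    twist-⊕ true  x y = refl
    twist-⊕ false x y = ⊖-distrib-⊕ x y

    twist-⊖ : ∀ s x y → twist s (x ⊖ y) ≡ twist s x ⊖ twist s y
    twist-⊖ true  x y = refl
    twist-⊖ false x y = ⊖-distrib-⊖ x y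

    N : EdgeSet Σ → ℕ
    N A = count (improperOn A) funs

    -- ⊖ fixes only zero, so fixedPoints ⊖_ computes to 1.
    N≡3^kb : ∀ A → N A ≡ 3 ^ kb Σ A
    N≡3^kb A = trans (Canonical.improper-count A zero) (trans (cong (3 ^ kb Σ A *_) (1^≈1 (ku Σ A))) (*-identityʳ _))

    module Deletion (A : EdgeSet Σ) (e : Edge Σ) (Ae : A e ≡ true) where

      A⁻ : EdgeSet Σ
      A⁻ x = A x ∧ not (x == e)

      card-A⁻ : card Σ A ≡ suc (card Σ A⁻)
      card-A⁻ = begin
        card Σ A                                                        ≡⟨ count-allFin _ A ⟩
        ∑[ x < nE Σ ] ⟦ A x ⟧                                            ≡⟨ sum-cong-≋ (λ x → ⟦⟧-split (A x) (x == e)) ⟩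
        ∑[ x < nE Σ ] (⟦ A⁻ x ⟧ + ⟦ A x ∧ (x == e) ⟧)                    ≡⟨ ∑-distrib-+ (λ x → ⟦ A⁻ x ⟧) _ ⟩
        ∑[ x < nE Σ ] ⟦ A⁻ x ⟧ + ∑[ x < nE Σ ] ⟦ A x ∧ (x == e) ⟧
                                                                        ≡⟨ cong₂ _+_ (sym (count-allFin _ A⁻)) (trans (sum-cong-≋ at-e) (∑-==ˡ _ e)) ⟩
        card Σ A⁻ + 1                                                   ≡⟨ +-comm (card Σ A⁻) 1 ⟩
        suc (card Σ A⁻)                                                 ∎
        where
        open ≡-Reasoning
        at-e : ∀ x → ⟦ A x ∧ (x == e) ⟧ ≡ ⟦ e == x ⟧
        at-e x with x ≟ e
        ... | yes refl = cong ⟦_⟧ (trans (∧-identityʳ (A e)) (trans Ae (sym (==-refl e))))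
        ... | no x≢e   = cong ⟦_⟧ (trans (∧-zeroʳ (A x)) (sym (≢⇒==false (x≢e ∘ sym))))

      defect : Colouring → ℤ₃
      defect f = f (ends₂ Σ e) ⊖ twist (sign Σ e) (f (ends₁ Σ e))

      defect-cong : ∀ {f f′} → (∀ v → f v ≡ f′ v) → defect f ≡ defect f′
      defect-cong f≗f′ = cong₂ _⊖_ (f≗f′ _) (cong (twist (sign Σ e)) (f≗f′ _))

      defect-⊕ : ∀ f g → defect (λ v → f v ⊕ g v) ≡ defect f ⊕ defect g
      defect-⊕ f g =
        trans (cong (_⊖_ (f b ⊕ g b)) (twist-⊕ s (f a) (g a))) (⊕-⊖-interchange (f b) (g b) (twist s (f a)) (twist s (g a)))
        where a = ends₁ Σ e ; b = ends₂ Σ e ; s = sign Σ e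

      defect-⊖ : ∀ f g → defect (λ v → f v ⊖ g v) ≡ defect f ⊖ defect g
      defect-⊖ f g =
        trans (cong (_⊖_ (f b ⊖ g b)) (twist-⊖ s (f a) (g a))) (⊖-⊖-interchange (f b) (g b) (twist s (f a)) (twist s (g a)))
        where a = ends₁ Σ e ; b = ends₂ Σ e ; s = sign Σ e

      defect≡zero : ∀ f → (defect f == zero) ≡ conflict f e
      defect≡zero f = trans (⊖==zero (f (ends₂ Σ e)) x) (trans (==-sym (f (ends₂ Σ e)) x) (sym (conflict≡ f e)))
        where x = twist (sign Σ e) (f (ends₁ Σ e))

      improperOn-A : ∀ f → improperOn A f ≡ (improperOn A⁻ f ∧ (defect f == zero))
      improperOn-A f = ≡true-ext
        (λ h → ∧-true⁺ (improperOn-mono {A} {A⁻} (λ x A⁻x → proj₁ (∧-true⁻ {A x} A⁻x)) {f} h)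
                       (trans (defect≡zero f) (conflictOn A {f} h Ae)))
        (λ h → let h⁻ , d₀ = ∧-true⁻ h in all⁺ _ (allFin (nE Σ)) λ {x} _ → at h⁻ d₀ x)
        where
        at : improperOn A⁻ f ≡ true → (defect f == zero) ≡ true → ∀ x → (not (A x) ∨ conflict f x) ≡ true
        at h⁻ d₀ x with x ≟ e
        ... | yes refl = ∨-true⁺ʳ (not (A e)) (trans (sym (defect≡zero f)) d₀)
        ... | no x≢e with A x in Ax
        ...   | false = refl
        ...   | true  = conflictOn A⁻ {f} h⁻ (∧-true⁺ Ax (cong not (≢⇒==false x≢e)))

      fibre : ℤ₃ → Colouring → Bool
      fibre c f = improperOn A⁻ f ∧ (defect f == c)

      fibre-translate : ∀ c → count (fibre c) funs ≤ count (fibre zero) funs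
      fibre-translate c with count (fibre c) funs in size
      ... | zero  = z≤n
      ... | suc _ with count-pos (fibre c) funs (subst (0 <_) (sym size) (s≤s z≤n))
      ... | g , g∈ = ≤-reflexive (trans (sym size) (count-bijection shift))
        where
        g⁻ : improperOn A⁻ g ≡ true
        g⁻ = proj₁ (∧-true⁻ {improperOn A⁻ g} g∈)
        dg : defect g ≡ c
        dg = ==⇒≡ (proj₂ (∧-true⁻ {improperOn A⁻ g} g∈))
        fibre-cong : ∀ c {f f′} → (∀ v → f v ≡ f′ v) → fibre c f ≡ fibre c f′
        fibre-cong c f≗f′ = cong₂ _∧_ (improperOn-cong A⁻ f≗f′) (cong (_== c) (defect-cong f≗f′))
        shift : CountingBijection (fibre c) (fibre zero)
        shift = record
          { to        = λ f v → f v ⊖ g v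
          ; from      = λ h v → h v ⊕ g v
          ; P-resp    = fibre-cong c
          ; Q-resp    = fibre-cong zero
          ; to-resp   = λ f≗f′ v → cong (_⊖ g v) (f≗f′ v)
          ; from-resp = λ h≗h′ v → cong (_⊕ g v) (h≗h′ v)
          ; to-Q      = λ f f∈ → let f⁻ , df = ∧-true⁻ {improperOn A⁻ f} f∈ in
              ∧-true⁺ (improperOn-pointwise _⊖_ twist-⊖ A⁻ {f} {g} f⁻ g⁻)
                      (subst (λ (z : ℤ₃) → (z == zero) ≡ true)
                             (sym (trans (defect-⊖ f g) (trans (cong₂ _⊖_ (==⇒≡ {b = c} df) dg) (⊖-self c)))) (==-refl (zero {2})))
          ; from-P    = λ h h∈ → let h⁻ , dh = ∧-true⁻ {improperOn A⁻ h} h∈ in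
              ∧-true⁺ (improperOn-pointwise _⊕_ twist-⊕ A⁻ {h} {g} h⁻ g⁻)
                      (subst (λ (z : ℤ₃) → (z == c) ≡ true)
                             (sym (trans (defect-⊕ h g) (trans (cong₂ _⊕_ (==⇒≡ {b = zero} dh) dg) (⊕-identityˡ c)))) (==-refl c))
          ; from∘to   = λ f _ v → ⊖-⊕-cancel (f v) (g v)
          ; to∘from   = λ h _ v → ⊕-⊖-cancel (h v) (g v)
          }

      N-A⁻ : N A⁻ ≤ 3 * N A
      N-A⁻ = begin
        N A⁻                                             ≡⟨ count≡∑ _ funs ⟩
        ∑[ f ∈ funs ] ⟦ improperOn A⁻ f ⟧                ≡⟨ ∑ₗ-cong funs (λ f → ⟦⟧-partition (improperOn A⁻ f) (defect f)) ⟩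
        ∑[ f ∈ funs ] ∑[ c ∈ allFin 3 ] ⟦ fibre c f ⟧    ≡⟨ ∑ₗ-comm funs (allFin 3) (λ f c → ⟦ fibre c f ⟧) ⟩
        ∑[ c ∈ allFin 3 ] ∑[ f ∈ funs ] ⟦ fibre c f ⟧    ≡⟨ ∑ₗ-cong (allFin 3) (λ c → sym (count≡∑ (fibre c) funs)) ⟩
        ∑[ c ∈ allFin 3 ] count (fibre c) funs           ≤⟨ ∑ₗ-mono (allFin 3) fibre-translate ⟩
        3 * count (fibre zero) funs                      ≡⟨ cong (3 *_) (count-cong funs (λ f → sym (improperOn-A f))) ⟩
        3 * N A                                          ∎
        where open ≤-Reasoning

    3^n≤3^k*N : ∀ k A → card Σ A ≡ k → 3 ^ n ≤ 3 ^ k * N A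
    3^n≤3^k*N zero A empty = ≤-reflexive (sym (begin-equality
      1 * N A                        ≡⟨ +-identityʳ (N A) ⟩
      N A                            ≡⟨ count-cong funs (λ f → all⁺ _ (allFin (nE Σ)) λ {e} _ → cong (λ a → not a ∨ _) (absent e)) ⟩
      count (λ _ → true) funs        ≡⟨ count-funs ⟩
      3 ^ n                          ∎))
      where
      open ≤-Reasoning
      absent : ∀ e → A e ≡ false
      absent = ∑⟦⟧≡0 (nE Σ) A (trans (sym (count-allFin (nE Σ) A)) empty)
    3^n≤3^k*N (suc k) A card≡ with count-pos A (allFin (nE Σ)) (subst (0 <_) (sym card≡) (s≤s z≤n))
    ... | e , Ae = begin
      3 ^ n               ≤⟨ 3^n≤3^k*N k A⁻ (suc-injective (trans (sym card-A⁻) card≡)) ⟩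
      3 ^ k * N A⁻        ≤⟨ *-monoʳ-≤ (3 ^ k) N-A⁻ ⟩
      3 ^ k * (3 * N A)   ≡⟨ sym (*-assoc (3 ^ k) 3 (N A)) ⟩
      3 ^ k * 3 * N A     ≡⟨ cong (_* N A) (*-comm (3 ^ k) 3) ⟩
      3 * 3 ^ k * N A     ∎
      where
      open ≤-Reasoning
      open Deletion A e Ae

    rank-bound : ∀ A → n ≤ card Σ A + kb Σ A
    rank-bound A = 3^-reflects-≤ n _ (begin
      3 ^ n                           ≤⟨ 3^n≤3^k*N (card Σ A) A refl ⟩
      3 ^ card Σ A * N A              ≡⟨ cong (3 ^ card Σ A *_) (N≡3^kb A) ⟩
      3 ^ card Σ A * 3 ^ kb Σ A       ≡⟨ sym (^-homo-* 3 (card Σ A) (kb Σ A)) ⟩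
      3 ^ (card Σ A + kb Σ A)         ∎)
      where
      open ≤-Reasoning
      3^>0 : ∀ a → 0 < 3 ^ a
      3^>0 zero    = s≤s z≤n
      3^>0 (suc a) = *-monoʳ-< 3 (3^>0 a)
      3^-reflects-≤ : ∀ a b → 3 ^ a ≤ 3 ^ b → a ≤ b
      3^-reflects-≤ zero    b       _ = z≤n
      3^-reflects-≤ (suc a) zero    h = ⊥-elim (<⇒≱ (≤-trans (s≤s (s≤s z≤n)) (*-monoʳ-≤ 3 (3^>0 a))) h)
      3^-reflects-≤ (suc a) (suc b) h = s≤s (3^-reflects-≤ a b (*-cancelˡ-≤ 3 h))

module Evaluation where

  open import Algebra.Bundles using (CommutativeRing)
  open import Data.Bool using (Bool; true; false; _∨_; not)
  open import Data.Nat as ℕ using (ℕ; zero; suc)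
  import Data.Nat.Properties as ℕ
  open import Data.Integer as ℤ using (+_; -[1+_])
  import Data.Integer.Properties as ℤ
  open import Data.Rational using (ℚ; _/_; _*_; _+_; _-_; -_; 1ℚ; 0ℚ)
  open import Data.Rational.Solver using (module +-*-Solver)
  import Data.Nat.Solver
  open import Data.Rational.Properties using (+-*-commutativeRing; *-assoc; *-identityˡ; *-identityʳ; neg-distribˡ-*; toℚᵘ-injective; toℚᵘ-fromℚᵘ; toℚᵘ-homo-+; toℚᵘ-homo-*)
  open import Data.Rational.Unnormalised using (mkℚᵘ; *≡*)
  import Data.Rational.Unnormalised.Properties as ℚᵘ
  open import Data.Fin as Fin using (Fin)
  open import Data.List using (List; []; _∷_; allFin)
  open import Data.Bool.ListAction using (all)
  open import Relation.Binary.PropositionalEquality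
  open import Defs hiding (_^_)
  module ℕ∑ = Enumeration
  open ℕ∑ using (module FunctionCounting) renaming (_^_ to _^ℕ_; ⟦_⟧ to ⟦_⟧ℕ; count≡∑ to count≡∑ℕ; count-allFin to count-allFinℕ)
  open ImproperColourings using (module Colourings)
  open Connectivity using (module ComponentCounts)
  open RankViaℤ₃ using (module RankBound)

  q : ℕ → ℚ
  q a = + a / 1

  -- Identities between normalised rationals are checked in ℚᵘ, where q a is mkℚᵘ (+ a) 0.
  q-+ : ∀ a b → q (a ℕ.+ b) ≡ q a + q b
  q-+ a b = toℚᵘ-injective (ℚᵘ.≃-trans (toℚᵘ-fromℚᵘ (mkℚᵘ (+ (a ℕ.+ b)) 0))
    (ℚᵘ.≃-trans (*≡* eq) (ℚᵘ.≃-sym (ℚᵘ.≃-trans (toℚᵘ-homo-+ (q a) (q b))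
      (ℚᵘ.+-cong (toℚᵘ-fromℚᵘ (mkℚᵘ (+ a) 0)) (toℚᵘ-fromℚᵘ (mkℚᵘ (+ b) 0)))))))
    where
    eq : + (a ℕ.+ b) ℤ.* + 1 ≡ (+ a ℤ.* + 1 ℤ.+ + b ℤ.* + 1) ℤ.* + 1
    eq = cong (ℤ._* + 1) (trans (ℤ.pos-+ a b) (sym (cong₂ ℤ._+_ (ℤ.*-identityʳ (+ a)) (ℤ.*-identityʳ (+ b)))))

  q-* : ∀ a b → q (a ℕ.* b) ≡ q a * q b
  q-* a b = toℚᵘ-injective (ℚᵘ.≃-trans (toℚᵘ-fromℚᵘ (mkℚᵘ (+ (a ℕ.* b)) 0))
    (ℚᵘ.≃-trans (*≡* (cong (ℤ._* + 1) (ℤ.pos-* a b))) (ℚᵘ.≃-sym (ℚᵘ.≃-trans (toℚᵘ-homo-* (q a) (q b))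
      (ℚᵘ.*-cong (toℚᵘ-fromℚᵘ (mkℚᵘ (+ a) 0)) (toℚᵘ-fromℚᵘ (mkℚᵘ (+ b) 0)))))))

  q*/ : ∀ t m → q (suc m) * (+ t / suc m) ≡ q t
  q*/ t m = toℚᵘ-injective (ℚᵘ.≃-trans (toℚᵘ-homo-* (q (suc m)) (+ t / suc m))
    (ℚᵘ.≃-trans (ℚᵘ.*-cong (toℚᵘ-fromℚᵘ (mkℚᵘ (+ suc m) 0)) (toℚᵘ-fromℚᵘ (mkℚᵘ (+ t) m)))
      (ℚᵘ.≃-trans (*≡* eq) (ℚᵘ.≃-sym (toℚᵘ-fromℚᵘ (mkℚᵘ (+ t) 0))))))
    where
    eq : (+ suc m ℤ.* + t) ℤ.* + 1 ≡ + t ℤ.* + suc (m ℕ.+ 0)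
    eq = trans (ℤ.*-identityʳ _) (trans (ℤ.*-comm (+ suc m) (+ t)) (cong (λ z → + t ℤ.* + suc z) (sym (ℕ.+-identityʳ m))))

  module Σℚ = FiniteSums (CommutativeRing.commutativeSemiring +-*-commutativeRing)
  open Σℚ using (∑ₗ; ⟦_⟧; ∏; _^_)

  q-^ : ∀ a k → q (a ^ℕ k) ≡ q a ^ k
  q-^ a zero    = refl
  q-^ a (suc k) = trans (q-* a (a ^ℕ k)) (cong (q a *_) (q-^ a k))

  q-⟦⟧ : ∀ b → q ⟦ b ⟧ℕ ≡ ⟦ b ⟧
  q-⟦⟧ true  = refl
  q-⟦⟧ false = refl

  q-∑ : ∀ {A : Set} (xs : List A) f → q (ℕ∑.∑ₗ xs f) ≡ ∑[ x ∈ xs ] q (f x)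
  q-∑ []       f = refl
  q-∑ (x ∷ xs) f = trans (q-+ (f x) _) (cong (_+_ (q (f x))) (q-∑ xs f))

  q-count : ∀ {A : Set} (p : A → Bool) xs → q (count p xs) ≡ ∑[ x ∈ xs ] ⟦ p x ⟧
  q-count p xs = trans (cong q (count≡∑ℕ p xs)) (trans (q-∑ xs _) (Σℚ.∑ₗ-cong xs (λ x → q-⟦⟧ (p x))))

  ^≡^ : ∀ x k → x Defs.^ k ≡ x ^ k
  ^≡^ x zero    = refl
  ^≡^ x (suc k) = cong (x *_) (^≡^ x k)


  -1ℚ : ℚ
  -1ℚ = -[1+ 0 ] / 1

  inclusion-exclusion : ∀ k (B : Fin k → Bool) →
    ∑[ A ∈ allFuns k (true ∷ false ∷ []) ] (-1ℚ ^ count A (allFin k) * ⟦ all (λ i → not (A i) ∨ B i) (allFin k) ⟧)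
    ≡ ⟦ all (λ i → not (B i)) (allFin k) ⟧
  inclusion-exclusion k B = begin
    ∑[ A ∈ subsets ] (-1ℚ ^ count A (allFin k) * ⟦ all (λ i → not (A i) ∨ B i) (allFin k) ⟧)
      ≡⟨ Σℚ.∑ₗ-cong subsets (λ A → cong₂ _*_ (trans (cong (-1ℚ ^_) (count-allFinℕ k A)) (Σℚ.^-∑ -1ℚ (λ i → ⟦ A i ⟧ℕ)))
                                              (Σℚ.⟦all-allFin⟧ k _)) ⟩
    ∑[ A ∈ subsets ] (∏ (λ i → -1ℚ ^ ⟦ A i ⟧ℕ) * ∏ (λ i → ⟦ not (A i) ∨ B i ⟧))
      ≡⟨ Σℚ.∑ₗ-cong subsets (λ A → sym (Σℚ.∏-distrib-* (λ i → -1ℚ ^ ⟦ A i ⟧ℕ) _)) ⟩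
    ∑[ A ∈ subsets ] ∏ (λ i → term i (A i))
      ≡⟨ Σℚ.∑-allFuns-∏ k (true ∷ false ∷ []) term ⟩
    ∏ (λ i → ∑[ a ∈ true ∷ false ∷ [] ] term i a)
      ≡⟨ Σℚ.∏-cong (λ i → single (B i)) ⟩
    ∏ (λ i → ⟦ not (B i) ⟧)
      ≡⟨ sym (Σℚ.⟦all-allFin⟧ k _) ⟩
    ⟦ all (λ i → not (B i)) (allFin k) ⟧ ∎
    where
    open ≡-Reasoning
    subsets = allFuns k (true ∷ false ∷ [])
    term : Fin k → Bool → ℚ
    term i a = -1ℚ ^ ⟦ a ⟧ℕ * ⟦ not a ∨ B i ⟧
    single : ∀ b → ∑[ a ∈ true ∷ false ∷ [] ] (-1ℚ ^ ⟦ a ⟧ℕ * ⟦ not a ∨ b ⟧) ≡ ⟦ not b ⟧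
    single true  = refl
    single false = refl

  module Expansion {n m : ℕ} (Σ : SignedGraph n) (ι : Fin m → Fin m) (ι-involutive : ∀ s → ι (ι s) ≡ s) where
    open Colourings Σ ι ι-involutive
    open FunctionCounting n m

    chromatic-expansion : q (chromatic Σ ι)
                        ≡ ∑[ A ∈ allEdgeSets Σ ] (-1ℚ ^ card Σ A * q (count (improperOn A) funs))
    chromatic-expansion = begin
      q (chromatic Σ ι)
        ≡⟨ q-count (proper Σ ι) funs ⟩
      ∑[ f ∈ funs ] ⟦ proper Σ ι f ⟧
        ≡⟨ Σℚ.∑ₗ-cong funs (λ f → cong ⟦_⟧ (proper≡ f)) ⟩
      ∑[ f ∈ funs ] ⟦ all (λ e → not (conflict f e)) (allFin (nE Σ)) ⟧
        ≡⟨ Σℚ.∑ₗ-cong funs (λ f → sym (inclusion-exclusion (nE Σ) (conflict f))) ⟩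
      ∑[ f ∈ funs ] ∑[ A ∈ allEdgeSets Σ ] (-1ℚ ^ card Σ A * ⟦ improperOn A f ⟧)
        ≡⟨ Σℚ.∑ₗ-comm funs (allEdgeSets Σ) _ ⟩
      ∑[ A ∈ allEdgeSets Σ ] ∑[ f ∈ funs ] (-1ℚ ^ card Σ A * ⟦ improperOn A f ⟧)
        ≡⟨ Σℚ.∑ₗ-cong (allEdgeSets Σ) (λ A → sym (Σℚ.*-distribˡ-∑ₗ funs (-1ℚ ^ card Σ A) (λ f → ⟦ improperOn A f ⟧))) ⟩
      ∑[ A ∈ allEdgeSets Σ ] (-1ℚ ^ card Σ A * ∑[ f ∈ funs ] ⟦ improperOn A f ⟧)
        ≡⟨ Σℚ.∑ₗ-cong (allEdgeSets Σ) (λ A → cong (-1ℚ ^ card Σ A *_) (sym (q-count (improperOn A) funs))) ⟩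
      ∑[ A ∈ allEdgeSets Σ ] (-1ℚ ^ card Σ A * q (count (improperOn A) funs))
        ∎
      where open ≡-Reasoning

  neg-^ : ∀ x k → (- x) ^ k ≡ -1ℚ ^ k * x ^ k
  neg-^ x k = trans (cong (_^ k) (trans (cong -_ (sym (*-identityˡ x))) (neg-distribˡ-* 1ℚ x))) (Σℚ.^-distrib-* -1ℚ x k)

  -1^-parity : ∀ a b c d → a ℕ.+ (c ℕ.+ c) ≡ b ℕ.+ (d ℕ.+ d) → -1ℚ ^ a ≡ -1ℚ ^ b
  -1^-parity a b c d eq = begin
    -1ℚ ^ a                          ≡⟨ sym (drop-even a c) ⟩
    -1ℚ ^ (a ℕ.+ (c ℕ.+ c))          ≡⟨ cong (-1ℚ ^_) eq ⟩
    -1ℚ ^ (b ℕ.+ (d ℕ.+ d))          ≡⟨ drop-even b d ⟩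
    -1ℚ ^ b                          ∎
    where
    open ≡-Reasoning
    drop-even : ∀ a c → -1ℚ ^ (a ℕ.+ (c ℕ.+ c)) ≡ -1ℚ ^ a
    drop-even a c = begin
      -1ℚ ^ (a ℕ.+ (c ℕ.+ c))                ≡⟨ Σℚ.^-homo-* -1ℚ a (c ℕ.+ c) ⟩
      -1ℚ ^ a * -1ℚ ^ (c ℕ.+ c)              ≡⟨ cong (-1ℚ ^ a *_) (Σℚ.^-homo-* -1ℚ c c) ⟩
      -1ℚ ^ a * (-1ℚ ^ c * -1ℚ ^ c)          ≡⟨ cong (-1ℚ ^ a *_) (sym (Σℚ.^-distrib-* -1ℚ -1ℚ c)) ⟩
      -1ℚ ^ a * 1ℚ ^ c                       ≡⟨ cong (-1ℚ ^ a *_) (Σℚ.1^≈1 c) ⟩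
      -1ℚ ^ a * 1ℚ                           ≡⟨ *-identityʳ _ ⟩
      -1ℚ ^ a                                ∎

  exponent-parity : ∀ {n kA card b u K d₁ d₂ d₃} → K ℕ.+ d₁ ≡ n → K ℕ.+ d₂ ≡ kA → n ℕ.+ d₃ ≡ card ℕ.+ b → kA ≡ b ℕ.+ u →
                    ((d₁ ℕ.+ d₂) ℕ.+ (d₃ ℕ.+ u)) ℕ.+ (K ℕ.+ K) ≡ card ℕ.+ ((b ℕ.+ u) ℕ.+ (b ℕ.+ u))
  exponent-parity {card = card} {b} {u} {K} {d₁} {d₂} {d₃} refl refl h₃ h₄ =
    trans (solve 5 (λ d₁ d₂ d₃ u K → ((d₁ :+ d₂) :+ (d₃ :+ u)) :+ (K :+ K) := (((K :+ d₁) :+ d₃) :+ (K :+ d₂)) :+ u) refl d₁ d₂ d₃ u K)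
    (trans (cong₂ (λ x y → (x ℕ.+ y) ℕ.+ u) h₃ h₄)
    (solve 3 (λ card b u → ((card :+ b) :+ (b :+ u)) :+ u := card :+ ((b :+ u) :+ (b :+ u))) refl card b u))
    where open Data.Nat.Solver.+-*-Solver

  module TutteEvaluation {n m′ : ℕ} (Σ : SignedGraph n) (ι : Fin (ℕ.suc m′) → Fin (ℕ.suc m′)) (ι-involutive : ∀ s → ι (ι s) ≡ s) where
    m : ℕ
    m = ℕ.suc m′

    M T : ℚ
    M = q m
    T = + fixedPoints ι / m

    K : ℕ
    K = kc Σ (fullSet Σ)

    tutteTerm : EdgeSet Σ → ℚ
    tutteTerm A = (- M) ^ (kc Σ A ℕ.∸ K) * (-1ℚ ^ ((card Σ A ℕ.+ kb Σ A) ℕ.∸ n) * (- T) ^ ku Σ A)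

    -- Defs.tutte sums with sumℚ ∘ map, which is ∑ₗ by definition.
    tutte≡ : tutte Σ (1ℚ - M) 0ℚ (1ℚ - T) ≡ ∑[ A ∈ allEdgeSets Σ ] tutteTerm A
    tutte≡ = Σℚ.∑ₗ-cong (allEdgeSets Σ) λ A →
      cong₂ _*_ (trans (^≡^ ((1ℚ - M) - 1ℚ) (kc Σ A ℕ.∸ K)) (cong (_^ (kc Σ A ℕ.∸ K)) (1-x-1≡-x M)))
                (cong₂ _*_ (^≡^ -1ℚ ((card Σ A ℕ.+ kb Σ A) ℕ.∸ n))
                           (trans (^≡^ ((1ℚ - T) - 1ℚ) (ku Σ A)) (cong (_^ ku Σ A) (1-x-1≡-x T))))
      where
      1-x-1≡-x : ∀ x → (1ℚ - x) - 1ℚ ≡ - x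
      1-x-1≡-x = solve 1 (λ x → (con 1ℚ :- x) :- con 1ℚ := :- x) refl
        where open +-*-Solver

    term-identity : ∀ A → (-1ℚ ^ (n ℕ.∸ K) * M ^ K) * tutteTerm A
                        ≡ -1ℚ ^ card Σ A * q (m ^ℕ kb Σ A ℕ.* fixedPoints ι ^ℕ ku Σ A)
    term-identity A = begin
      (-1ℚ ^ d₁ * M ^ K) * ((- M) ^ d₂ * (-1ℚ ^ d₃ * (- T) ^ u))
        ≡⟨ cong₂ (λ x y → (-1ℚ ^ d₁ * M ^ K) * (x * (-1ℚ ^ d₃ * y))) (neg-^ M d₂) (neg-^ T u) ⟩
      (-1ℚ ^ d₁ * M ^ K) * ((-1ℚ ^ d₂ * M ^ d₂) * (-1ℚ ^ d₃ * (-1ℚ ^ u * T ^ u)))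
        ≡⟨ regroup (-1ℚ ^ d₁) (M ^ K) (-1ℚ ^ d₂) (M ^ d₂) (-1ℚ ^ d₃) (-1ℚ ^ u) (T ^ u) ⟩
      ((-1ℚ ^ d₁ * -1ℚ ^ d₂) * (-1ℚ ^ d₃ * -1ℚ ^ u)) * ((M ^ K * M ^ d₂) * T ^ u)
        ≡⟨ cong₂ (λ x y → x * (y * T ^ u)) signs (sym (Σℚ.^-homo-* M K d₂)) ⟩
      -1ℚ ^ ((d₁ ℕ.+ d₂) ℕ.+ (d₃ ℕ.+ u)) * (M ^ (K ℕ.+ d₂) * T ^ u)
        ≡⟨ cong₂ (λ x y → x * (M ^ y * T ^ u)) (-1^-parity ((d₁ ℕ.+ d₂) ℕ.+ (d₃ ℕ.+ u)) (card Σ A) K (b ℕ.+ u) parity) (trans h₂ h₄) ⟩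
      -1ℚ ^ card Σ A * (M ^ (b ℕ.+ u) * T ^ u)
        ≡⟨ cong (-1ℚ ^ card Σ A *_) colours ⟩
      -1ℚ ^ card Σ A * q (m ^ℕ b ℕ.* fixedPoints ι ^ℕ u) ∎
      where
      open ≡-Reasoning
      d₁ = n ℕ.∸ K
      d₂ = kc Σ A ℕ.∸ K
      d₃ = (card Σ A ℕ.+ kb Σ A) ℕ.∸ n
      b = kb Σ A
      u = ku Σ A
      h₁ : K ℕ.+ d₁ ≡ n
      h₁ = ℕ.m+[n∸m]≡n (ComponentCounts.kc≤n Σ (fullSet Σ))
      h₂ : K ℕ.+ d₂ ≡ kc Σ A
      h₂ = ℕ.m+[n∸m]≡n (ComponentCounts.kc-antitone Σ (λ _ _ → refl))
      h₃ : n ℕ.+ d₃ ≡ card Σ A ℕ.+ kb Σ A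
      h₃ = ℕ.m+[n∸m]≡n (RankBound.rank-bound Σ A)
      h₄ : kc Σ A ≡ b ℕ.+ u
      h₄ = ComponentCounts.kc≡kb+ku Σ A
      parity : ((d₁ ℕ.+ d₂) ℕ.+ (d₃ ℕ.+ u)) ℕ.+ (K ℕ.+ K) ≡ card Σ A ℕ.+ ((b ℕ.+ u) ℕ.+ (b ℕ.+ u))
      parity = exponent-parity {n} {kc Σ A} {card Σ A} {b} {u} {K} {d₁} {d₂} {d₃} h₁ h₂ h₃ h₄
      regroup : ∀ a₁ a₂ a₃ a₄ a₅ a₆ a₇ → (a₁ * a₂) * ((a₃ * a₄) * (a₅ * (a₆ * a₇)))
                                        ≡ ((a₁ * a₃) * (a₅ * a₆)) * ((a₂ * a₄) * a₇)
      regroup = solve 7 (λ a₁ a₂ a₃ a₄ a₅ a₆ a₇ → (a₁ :* a₂) :* ((a₃ :* a₄) :* (a₅ :* (a₆ :* a₇)))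
                                                 := ((a₁ :* a₃) :* (a₅ :* a₆)) :* ((a₂ :* a₄) :* a₇)) refl
        where open +-*-Solver
      signs : (-1ℚ ^ d₁ * -1ℚ ^ d₂) * (-1ℚ ^ d₃ * -1ℚ ^ u) ≡ -1ℚ ^ ((d₁ ℕ.+ d₂) ℕ.+ (d₃ ℕ.+ u))
      signs = sym (trans (Σℚ.^-homo-* -1ℚ (d₁ ℕ.+ d₂) (d₃ ℕ.+ u))
                         (cong₂ _*_ (Σℚ.^-homo-* -1ℚ d₁ d₂) (Σℚ.^-homo-* -1ℚ d₃ u)))
      colours : M ^ (b ℕ.+ u) * T ^ u ≡ q (m ^ℕ b ℕ.* fixedPoints ι ^ℕ u)
      colours = begin
        M ^ (b ℕ.+ u) * T ^ u                     ≡⟨ cong (_* T ^ u) (Σℚ.^-homo-* M b u) ⟩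
        M ^ b * M ^ u * T ^ u                     ≡⟨ *-assoc (M ^ b) (M ^ u) (T ^ u) ⟩
        M ^ b * (M ^ u * T ^ u)                   ≡⟨ cong (M ^ b *_) (sym (Σℚ.^-distrib-* M T u)) ⟩
        M ^ b * (M * T) ^ u                       ≡⟨ cong (λ x → M ^ b * x ^ u) (q*/ (fixedPoints ι) m′) ⟩
        M ^ b * q (fixedPoints ι) ^ u             ≡⟨ sym (trans (q-* (m ^ℕ b) _) (cong₂ _*_ (q-^ m b) (q-^ (fixedPoints ι) u))) ⟩
        q (m ^ℕ b ℕ.* fixedPoints ι ^ℕ u)     ∎

    open Expansion Σ ι ι-involutive using (chromatic-expansion)

    tutte-evaluation : q (chromatic Σ ι) ≡ (-1ℚ ^ (n ℕ.∸ K) * M ^ K) * ∑[ A ∈ allEdgeSets Σ ] tutteTerm A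
    tutte-evaluation = begin
      q (chromatic Σ ι)
        ≡⟨ chromatic-expansion ⟩
      ∑[ A ∈ allEdgeSets Σ ] (-1ℚ ^ card Σ A * q (count (improperOn A) funs))
        ≡⟨ Σℚ.∑ₗ-cong (allEdgeSets Σ) (λ A → cong (λ k → -1ℚ ^ card Σ A * q k) (Canonical.improper-count A Fin.zero)) ⟩
      ∑[ A ∈ allEdgeSets Σ ] (-1ℚ ^ card Σ A * q (m ^ℕ kb Σ A ℕ.* fixedPoints ι ^ℕ ku Σ A))
        ≡⟨ Σℚ.∑ₗ-cong (allEdgeSets Σ) (λ A → sym (term-identity A)) ⟩
      ∑[ A ∈ allEdgeSets Σ ] ((-1ℚ ^ (n ℕ.∸ K) * M ^ K) * tutteTerm A)
        ≡⟨ sym (Σℚ.*-distribˡ-∑ₗ (allEdgeSets Σ) (-1ℚ ^ (n ℕ.∸ K) * M ^ K) tutteTerm) ⟩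
      (-1ℚ ^ (n ℕ.∸ K) * M ^ K) * ∑[ A ∈ allEdgeSets Σ ] tutteTerm A
        ∎
      where
      open ≡-Reasoning
      open Colourings Σ ι ι-involutive
      open FunctionCounting n m

open import Defs
open import Data.Nat as ℕ using (ℕ; NonZero)
open import Data.Fin using (Fin)
open import Data.Integer as ℤ using (+_; -[1+_])
open import Data.Rational using (ℚ; _/_; _*_; _-_; 1ℚ; 0ℚ)
open import Relation.Binary.PropositionalEquality using (_≡_)
open import Data.Rational.Properties using (*-assoc)
open import Relation.Binary.PropositionalEquality using (sym; cong₂; module ≡-Reasoning)
open Evaluation

theorem6p5 : ∀ {n m : ℕ} .{{_ : NonZero m}} (Σ : SignedGraph n) (ι : Fin m → Fin m)
  → (∀ s → ι (ι s) ≡ s)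
  → (+ chromatic Σ ι) / 1
    ≡ ((-[1+ 0 ] / 1) ^ (n ℕ.∸ kc Σ (fullSet Σ)))
      * (((+ m / 1) ^ kc Σ (fullSet Σ))
      * tutte Σ (1ℚ - (+ m / 1)) 0ℚ (1ℚ - (+ fixedPoints ι / m)))
theorem6p5 {m = ℕ.zero} {{()}} Σ ι ι-involutive
theorem6p5 {n} {ℕ.suc m′} Σ ι ι-involutive = begin
  q (chromatic Σ ι)                                    ≡⟨ tutte-evaluation ⟩
  (-1ℚ Σℚ.^ (n ℕ.∸ K) * M Σℚ.^ K) * Σℚ.∑ₗ (allEdgeSets Σ) tutteTerm
      ≡⟨ cong₂ _*_ (sym (cong₂ _*_ (^≡^ -1ℚ (n ℕ.∸ K)) (^≡^ M K))) (sym tutte≡) ⟩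
  (-1ℚ ^ (n ℕ.∸ K) * M ^ K) * tutte Σ (1ℚ - M) 0ℚ (1ℚ - T)
      ≡⟨ *-assoc (-1ℚ ^ (n ℕ.∸ K)) (M ^ K) _ ⟩
  -1ℚ ^ (n ℕ.∸ K) * (M ^ K * tutte Σ (1ℚ - M) 0ℚ (1ℚ - T)) ∎
  where
  open ≡-Reasoning
  open TutteEvaluation Σ ι ι-involutive
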